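{- Let $S(x)$ be an $L$ clause set cycle (with $x$ a variable of sort $\mathsf{nat}$). Then $I\exists_1 \vdash \neg S(x)$, i.e. the universal closure of $\neg S(x)$ is derivable from the theory $I\exists_1$ over $L$.
   Context: We work in many-sorted classical first-order logic over a language $L$ with finitely many sorts, among them a sort $\mathsf{nat}$, and containing function symbols $0:\mathsf{nat}$ and $s:\mathsf{nat}\to\mathsf{nat}$. A literal is an atom or negated atom; an $L$ clause is a formula $\forall\vec y\,(l_1\vee\dots\vee l_k)$ with literals $l_i$; an $L$ clause set is a finite conjunction of $L$ clauses. $\varphi\models\psi$ means every structure and variable assignment satisfying $\varphi$ satisfies $\psi$. An $L$ clause set $S(x)$ (only free variable $x$ of sort $\mathsf{nat}$) is an $L$ clause set cycle if $S(sx)\models S(x)$ and $S(0)\models\bot$. For a formula $\psi(x,\vec z)$ with $x$ of sort $\mathsf{nat}$, the induction axiom is $I_x\psi := \forall\vec z\,(\psi(0,\vec z)\to\forall x\,(\psi(x,\vec z)\to\psi(sx,\vec z))\to\forall x\,\psi(x,\vec z))$. An $\exists_1$ formula is one of the form $\exists\vec x\,\varphi$ with $\varphi$ quantifier-free. The theory $I\exists_1$ (over $L$) is the set of all $I_x\psi$ with $\psi(x,\vec z)$ an $\exists_1$ $L$ formula and $x$ of sort $\mathsf{nat}$ (no further axioms). -}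

module Defs where

open import Data.Nat using (ℕ)
open import Data.Fin using (Fin)
open import Data.List using (List; []; _∷_; _++_; map)
open import Data.List.Membership.Propositional using (_∈_)
open import Data.List.Relation.Unary.Any using (here; there)
open import Data.List.Relation.Unary.All using (All; []; _∷_; lookup)
open import Data.Product using (Σ; _×_; _,_)
open import Data.Sum using (_⊎_)
open import Data.Empty using (⊥)
open import Relation.Binary.PropositionalEquality using (_≡_; refl)

record Language : Set₁ where
  field
    numSorts : ℕ
    Fun      : List (Fin numSorts) → Fin numSorts → Set
    Pred     : List (Fin numSorts) → Set
    nat      : Fin numSorts
    zeroᶠ    : Fun [] nat
    succᶠ    : Fun (nat ∷ []) nat

module FOL (L : Language) where
  open Language L public

  Sort : Set
  Sort = Fin numSorts

  Ctx : Set
  Ctx = List Sort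

  variable
    s t : Sort
    ss : List Sort
    Γ Δ : Ctx

  mutual
    data Term (Γ : Ctx) : Sort → Set where
      var : s ∈ Γ → Term Γ s
      app : Fun ss s → Terms Γ ss → Term Γ s

    data Terms (Γ : Ctx) : List Sort → Set where
      []  : Terms Γ []
      _∷_ : Term Γ s → Terms Γ ss → Terms Γ (s ∷ ss)

  infixr 6 _∧'_
  infixr 5 _∨'_
  infixr 4 _⇒_
  infix 7 _≐_

  data Formula (Γ : Ctx) : Set where
    atom : Pred ss → Terms Γ ss → Formula Γ
    _≐_  : Term Γ s → Term Γ s → Formula Γ
    ⊥'   : Formula Γ
    _⇒_  : Formula Γ → Formula Γ → Formula Γ
    _∧'_ : Formula Γ → Formula Γ → Formula Γ
    _∨'_ : Formula Γ → Formula Γ → Formula Γ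
    ∀'   : (s : Sort) → Formula (s ∷ Γ) → Formula Γ
    ∃'   : (s : Sort) → Formula (s ∷ Γ) → Formula Γ

  ¬' : Formula Γ → Formula Γ
  ¬' φ = φ ⇒ ⊥'

  ⊤' : Formula Γ
  ⊤' = ¬' ⊥'

  ∀* : (vs : List Sort) → Formula (vs ++ Γ) → Formula Γ
  ∀* [] φ = φ
  ∀* (v ∷ vs) φ = ∀* vs (∀' v φ)

  ∃* : (vs : List Sort) → Formula (vs ++ Γ) → Formula Γ
  ∃* [] φ = φ
  ∃* (v ∷ vs) φ = ∃* vs (∃' v φ)

  ∀ᶜ : (Γ : Ctx) → Formula Γ → Formula []
  ∀ᶜ [] φ = φ
  ∀ᶜ (s ∷ Γ) φ = ∀ᶜ Γ (∀' s φ)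

  data QuantifierFree {Γ : Ctx} : Formula Γ → Set where
    atom : (p : Pred ss) (ts : Terms Γ ss) → QuantifierFree (atom p ts)
    eq   : (a b : Term Γ s) → QuantifierFree (a ≐ b)
    bot  : QuantifierFree ⊥'
    imp  : {φ ψ : Formula Γ} → QuantifierFree φ → QuantifierFree ψ → QuantifierFree (φ ⇒ ψ)
    and  : {φ ψ : Formula Γ} → QuantifierFree φ → QuantifierFree ψ → QuantifierFree (φ ∧' ψ)
    or   : {φ ψ : Formula Γ} → QuantifierFree φ → QuantifierFree ψ → QuantifierFree (φ ∨' ψ)

  Ren : Ctx → Ctx → Set
  Ren Γ Δ = ∀ {s} → s ∈ Γ → s ∈ Δ

  liftR : Ren Γ Δ → Ren (t ∷ Γ) (t ∷ Δ)
  liftR ρ (here p) = here p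
  liftR ρ (there v) = there (ρ v)

  mutual
    renT : Ren Γ Δ → Term Γ s → Term Δ s
    renT ρ (var v) = var (ρ v)
    renT ρ (app f ts) = app f (renTs ρ ts)

    renTs : Ren Γ Δ → Terms Γ ss → Terms Δ ss
    renTs ρ [] = []
    renTs ρ (t ∷ ts) = renT ρ t ∷ renTs ρ ts

  renF : Ren Γ Δ → Formula Γ → Formula Δ
  renF ρ (atom p ts) = atom p (renTs ρ ts)
  renF ρ (a ≐ b) = renT ρ a ≐ renT ρ b
  renF ρ ⊥' = ⊥'
  renF ρ (φ ⇒ ψ) = renF ρ φ ⇒ renF ρ ψ
  renF ρ (φ ∧' ψ) = renF ρ φ ∧' renF ρ ψ
  renF ρ (φ ∨' ψ) = renF ρ φ ∨' renF ρ ψ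
  renF ρ (∀' s φ) = ∀' s (renF (liftR ρ) φ)
  renF ρ (∃' s φ) = ∃' s (renF (liftR ρ) φ)

  Sub : Ctx → Ctx → Set
  Sub Γ Δ = ∀ {s} → s ∈ Γ → Term Δ s

  liftS : Sub Γ Δ → Sub (t ∷ Γ) (t ∷ Δ)
  liftS σ (here p) = var (here p)
  liftS σ (there v) = renT there (σ v)

  mutual
    subT : Sub Γ Δ → Term Γ s → Term Δ s
    subT σ (var v) = σ v
    subT σ (app f ts) = app f (subTs σ ts)

    subTs : Sub Γ Δ → Terms Γ ss → Terms Δ ss
    subTs σ [] = []
    subTs σ (t ∷ ts) = subT σ t ∷ subTs σ ts

  subF : Sub Γ Δ → Formula Γ → Formula Δ
  subF σ (atom p ts) = atom p (subTs σ ts)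
  subF σ (a ≐ b) = subT σ a ≐ subT σ b
  subF σ ⊥' = ⊥'
  subF σ (φ ⇒ ψ) = subF σ φ ⇒ subF σ ψ
  subF σ (φ ∧' ψ) = subF σ φ ∧' subF σ ψ
  subF σ (φ ∨' ψ) = subF σ φ ∨' subF σ ψ
  subF σ (∀' s φ) = ∀' s (subF (liftS σ) φ)
  subF σ (∃' s φ) = ∃' s (subF (liftS σ) φ)

  wk : Formula Γ → Formula (s ∷ Γ)
  wk = renF there

  wkClosed : (Γ : Ctx) → Formula [] → Formula Γ
  wkClosed Γ = renF (λ ())

  σ₀ : Term Γ s → Sub (s ∷ Γ) Γ
  σ₀ u (here refl) = u
  σ₀ u (there v) = var v

  _[_] : Formula (s ∷ Γ) → Term Γ s → Formula Γ
  φ [ u ] = subF (σ₀ u) φ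

  zeroT : Term Γ nat
  zeroT = app zeroᶠ []

  succT : Term Γ nat → Term Γ nat
  succT u = app succᶠ (u ∷ [])

  at0 : Formula (nat ∷ Γ) → Formula Γ
  at0 φ = φ [ zeroT ]

  σsucc : Sub (nat ∷ Γ) (nat ∷ Γ)
  σsucc (here refl) = succT (var (here refl))
  σsucc (there v) = var (there v)

  atSucc : Formula (nat ∷ Γ) → Formula (nat ∷ Γ)
  atSucc = subF σsucc

  data Atom (Γ : Ctx) : Set where
    atom : Pred ss → Terms Γ ss → Atom Γ
    _≐_  : Term Γ s → Term Γ s → Atom Γ

  atomF : Atom Γ → Formula Γ
  atomF (atom p ts) = atom p ts
  atomF (a ≐ b) = a ≐ b

  data Literal (Γ : Ctx) : Set where
    pos : Atom Γ → Literal Γ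
    neg : Atom Γ → Literal Γ

  litF : Literal Γ → Formula Γ
  litF (pos a) = atomF a
  litF (neg a) = ¬' (atomF a)

  ⋁ : List (Formula Γ) → Formula Γ
  ⋁ [] = ⊥'
  ⋁ (φ ∷ []) = φ
  ⋁ (φ ∷ ψ ∷ φs) = φ ∨' ⋁ (ψ ∷ φs)

  ⋀ : List (Formula Γ) → Formula Γ
  ⋀ [] = ⊤'
  ⋀ (φ ∷ []) = φ
  ⋀ (φ ∷ ψ ∷ φs) = φ ∧' ⋀ (ψ ∷ φs)

  record Clause (Γ : Ctx) : Set where
    constructor clause
    field
      vars : List Sort
      lits : List (Literal (vars ++ Γ))

  clauseF : Clause Γ → Formula Γ
  clauseF (clause vs ls) = ∀* vs (⋁ (map litF ls))

  ClauseSet : Ctx → Set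
  ClauseSet Γ = List (Clause Γ)

  clauseSetF : ClauseSet Γ → Formula Γ
  clauseSetF S = ⋀ (map clauseF S)

  record Structure : Set₁ where
    field
      Carrier   : Sort → Set
      inhabited : (s : Sort) → Carrier s
      funᴵ      : Fun ss s → All Carrier ss → Carrier s
      predᴵ     : Pred ss → All Carrier ss → Set

  module _ (M : Structure) where
    open Structure M

    Assignment : Ctx → Set
    Assignment Γ = All Carrier Γ

    mutual
      evalT : Assignment Γ → Term Γ s → Carrier s
      evalT ρ (var v) = lookup ρ v
      evalT ρ (app f ts) = funᴵ f (evalTs ρ ts)

      evalTs : Assignment Γ → Terms Γ ss → All Carrier ss
      evalTs ρ [] = []
      evalTs ρ (t ∷ ts) = evalT ρ t ∷ evalTs ρ ts

    Sat : Assignment Γ → Formula Γ → Set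
    Sat ρ (atom p ts) = predᴵ p (evalTs ρ ts)
    Sat ρ (a ≐ b) = evalT ρ a ≡ evalT ρ b
    Sat ρ ⊥' = ⊥
    Sat ρ (φ ⇒ ψ) = Sat ρ φ → Sat ρ ψ
    Sat ρ (φ ∧' ψ) = Sat ρ φ × Sat ρ ψ
    Sat ρ (φ ∨' ψ) = Sat ρ φ ⊎ Sat ρ ψ
    Sat ρ (∀' s φ) = (a : Carrier s) → Sat (a ∷ ρ) φ
    Sat ρ (∃' s φ) = Σ (Carrier s) λ a → Sat (a ∷ ρ) φ

  _⊨_ : Formula Γ → Formula Γ → Set₁
  _⊨_ {Γ} φ ψ = (M : Structure) (ρ : Assignment M Γ) → Sat M ρ φ → Sat M ρ ψ

  record IsClauseSetCycle (S : ClauseSet (nat ∷ [])) : Set₁ where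
    field
      step : atSucc (clauseSetF S) ⊨ clauseSetF S
      base : at0 (clauseSetF S) ⊨ ⊥'

  infix 3 _⊢[_]_

  data _⊢[_]_ : List (Formula Γ) → (Γ : Ctx) → Formula Γ → Set where
    hyp   : {Hs : List (Formula Γ)} {φ : Formula Γ} → φ ∈ Hs → Hs ⊢[ Γ ] φ
    ⊥E    : {Hs : List (Formula Γ)} {φ : Formula Γ} → Hs ⊢[ Γ ] ⊥' → Hs ⊢[ Γ ] φ
    raa   : {Hs : List (Formula Γ)} {φ : Formula Γ} → (¬' φ ∷ Hs) ⊢[ Γ ] ⊥' → Hs ⊢[ Γ ] φ
    ⇒I    : {Hs : List (Formula Γ)} {φ ψ : Formula Γ} → (φ ∷ Hs) ⊢[ Γ ] ψ → Hs ⊢[ Γ ] φ ⇒ ψ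
    ⇒E    : {Hs : List (Formula Γ)} {φ ψ : Formula Γ} → Hs ⊢[ Γ ] φ ⇒ ψ → Hs ⊢[ Γ ] φ → Hs ⊢[ Γ ] ψ
    ∧I    : {Hs : List (Formula Γ)} {φ ψ : Formula Γ} → Hs ⊢[ Γ ] φ → Hs ⊢[ Γ ] ψ → Hs ⊢[ Γ ] φ ∧' ψ
    ∧E₁   : {Hs : List (Formula Γ)} {φ ψ : Formula Γ} → Hs ⊢[ Γ ] φ ∧' ψ → Hs ⊢[ Γ ] φ
    ∧E₂   : {Hs : List (Formula Γ)} {φ ψ : Formula Γ} → Hs ⊢[ Γ ] φ ∧' ψ → Hs ⊢[ Γ ] ψ
    ∨I₁   : {Hs : List (Formula Γ)} {φ ψ : Formula Γ} → Hs ⊢[ Γ ] φ → Hs ⊢[ Γ ] φ ∨' ψ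
    ∨I₂   : {Hs : List (Formula Γ)} {φ ψ : Formula Γ} → Hs ⊢[ Γ ] ψ → Hs ⊢[ Γ ] φ ∨' ψ
    ∨E    : {Hs : List (Formula Γ)} {φ ψ χ : Formula Γ} → Hs ⊢[ Γ ] φ ∨' ψ →
            (φ ∷ Hs) ⊢[ Γ ] χ → (ψ ∷ Hs) ⊢[ Γ ] χ → Hs ⊢[ Γ ] χ
    ∀I    : {Hs : List (Formula Γ)} {s : Sort} {φ : Formula (s ∷ Γ)} →
            map (wk {s = s}) Hs ⊢[ s ∷ Γ ] φ → Hs ⊢[ Γ ] ∀' s φ
    ∀E    : {Hs : List (Formula Γ)} {s : Sort} {φ : Formula (s ∷ Γ)} →
            Hs ⊢[ Γ ] ∀' s φ → (u : Term Γ s) → Hs ⊢[ Γ ] φ [ u ]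
    ∃I    : {Hs : List (Formula Γ)} {s : Sort} {φ : Formula (s ∷ Γ)} →
            (u : Term Γ s) → Hs ⊢[ Γ ] φ [ u ] → Hs ⊢[ Γ ] ∃' s φ
    ∃E    : {Hs : List (Formula Γ)} {s : Sort} {φ : Formula (s ∷ Γ)} {ψ : Formula Γ} →
            Hs ⊢[ Γ ] ∃' s φ → (φ ∷ map (wk {s = s}) Hs) ⊢[ s ∷ Γ ] wk ψ → Hs ⊢[ Γ ] ψ
    ≐refl : {Hs : List (Formula Γ)} {s : Sort} (u : Term Γ s) → Hs ⊢[ Γ ] u ≐ u
    ≐E    : {Hs : List (Formula Γ)} {s : Sort} {u v : Term Γ s} (φ : Formula (s ∷ Γ)) →
            Hs ⊢[ Γ ] u ≐ v → Hs ⊢[ Γ ] φ [ u ] → Hs ⊢[ Γ ] φ [ v ]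

  Theory : Set₁
  Theory = Formula [] → Set

  -- T ⊢ φ : φ is derivable from finitely many axioms of T. Derivations may
  -- use auxiliary free variables (context Γ), which reflects the standard
  -- convention that domains are nonempty.
  _⊢_ : Theory → Formula [] → Set
  T ⊢ φ = Σ (List (Formula [])) λ Ax → All T Ax ×
          Σ Ctx λ Γ → map (wkClosed Γ) Ax ⊢[ Γ ] wkClosed Γ φ

  IndAx : (zs : Ctx) → Formula (nat ∷ zs) → Formula []
  IndAx zs ψ = ∀ᶜ zs (at0 ψ ⇒ ∀' nat (ψ ⇒ atSucc ψ) ⇒ ∀' nat ψ)

  data I∃₁ : Theory where
    ind : (zs ys : Ctx) (χ : Formula (ys ++ nat ∷ zs)) → QuantifierFree χ →
          I∃₁ (IndAx zs (∃* ys χ))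

{-# OPTIONS --safe #-}
-- Write S(x) in prenex form ∀ȳ N(x, ȳ) with N quantifier-free and put ψ(x) := ∃ȳ ¬N(x, ȳ), an ∃₁ formula
-- equivalent to ¬S(x).  The cycle conditions say semantically that ψ(0) holds and that ψ(x) entails ψ(sx);
-- once the existential quantifiers of ψ are eliminated, both are refutations of finite sets of universal
-- formulas, and the completeness theorem for such sets turns them into derivations.  The induction axiom
-- I_x ψ then gives ψ(x), which refutes S(x).
--
-- Completeness for universal hypotheses uses a term model: extend the consistent hypotheses by a Lindenbaum
-- chain deciding every atom over the terms built from their symbols, and interpret each term by a canonical
-- representative of its class modulo provable equality.
module Submission where

open import Defs
open import Data.Nat using (ℕ; zero; suc; _⊔_; _≤′_; ≤′-refl; ≤′-step)
open import Data.Nat.Properties using (≤⇒≤′; m≤m⊔n; m≤n⊔m)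
open import Data.List using (List; []; _∷_; _++_; map; concatMap; cartesianProductWith; allFin)
open import Data.List.Properties using (map-id; map-cong; map-∘; ++-identityʳ; ++-assoc)
open import Data.List.Membership.Propositional using (_∈_)
open import Data.List.Membership.Propositional.Properties
  using (∈-++⁺ˡ; ∈-++⁺ʳ; ∈-map⁺; ∈-concat⁺′; ∈-cartesianProductWith⁺; ∈-cartesianProductWith⁻; ∈-allFin)
open import Data.Fin using (_≟_)
open import Data.List.Relation.Binary.Subset.Propositional using (_⊆_)
import Data.List.Relation.Binary.Subset.Propositional.Properties as ⊆
open import Data.List.Relation.Unary.Any as Any using (Any; here; there)
open import Relation.Binary.PropositionalEquality
  using (_≡_; _≢_; refl; sym; trans; cong; cong₂; subst; subst₂; module ≡-Reasoning)
open import Data.List.Relation.Unary.All as All using (All; []; _∷_; lookup)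
open import Data.List.Relation.Unary.All.Properties using (++⁺; ++⁻ˡ; ++⁻ʳ; map⁺; map⁻)
open import Data.Product using (Σ; _×_; _,_; proj₁; proj₂)
open import Data.Sum using (_⊎_; inj₁; inj₂)
import Data.Sum as Sum
open import Data.Empty using (⊥; ⊥-elim)
open import Data.Unit using (⊤)
open import Data.Product.Function.NonDependent.Propositional using (_×-⇔_)
open import Data.Sum.Function.Propositional using (_⊎-⇔_)
open import Function using (_∘_)
open import Axiom.UniquenessOfIdentityProofs.WithK using (uip)
open import Level using (0ℓ)
open import Relation.Nullary using (¬_; Dec; yes; no; contradiction)
open import Axiom.ExcludedMiddle using (ExcludedMiddle)
open import Axiom.DoubleNegationElimination using (DoubleNegationElimination; em⇒dne)
open import Function.Bundles using (_⇔_; mk⇔; Equivalence)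
open import Function.Properties.Equivalence using () renaming (refl to ⇔-refl; sym to ⇔-sym; trans to ⇔-trans)
open import Function.Related.TypeIsomorphisms using (→-cong-⇔; ¬-cong-⇔)
open import Function.Related.Propositional using (equivalence)
import Function.Related.Propositional as Related
open Equivalence using (to; from)

module _ {A : Set} where

  embedˡ : {x : A} (xs ys : List A) {zs : List A} → x ∈ xs ++ zs → x ∈ (xs ++ ys) ++ zs
  embedˡ [] ys v = ∈-++⁺ʳ ys v
  embedˡ (x ∷ xs) ys (here p) = here p
  embedˡ (x ∷ xs) ys (there v) = there (embedˡ xs ys v)

  embedʳ : {x : A} (xs : List A) {ys zs : List A} → x ∈ ys ++ zs → x ∈ (xs ++ ys) ++ zs
  embedʳ [] v = v
  embedʳ (x ∷ xs) v = there (embedʳ xs v)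

  ⊆-++⁻ˡ : {xs ys zs : List A} → xs ++ ys ⊆ zs → xs ⊆ zs
  ⊆-++⁻ˡ {xs} {ys} i = i ∘ ⊆.xs⊆xs++ys xs ys

  ⊆-++⁻ʳ : (xs : List A) {ys zs : List A} → xs ++ ys ⊆ zs → ys ⊆ zs
  ⊆-++⁻ʳ xs {ys} i = i ∘ ⊆.xs⊆ys++xs ys xs

module _ {A : Set} {P : A → Set} where

  lookup-∈-++⁺ʳ : {x : A} {xs ys : List A} (as : All P xs) (ρ : All P ys) (v : x ∈ ys) →
                  lookup (++⁺ as ρ) (∈-++⁺ʳ xs v) ≡ lookup ρ v
  lookup-∈-++⁺ʳ [] ρ v = refl
  lookup-∈-++⁺ʳ (a ∷ as) ρ v = lookup-∈-++⁺ʳ as ρ v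

  lookup-embedˡ : {x : A} {xs ys zs : List A} (as : All P xs) (bs : All P ys) (ρ : All P zs) (v : x ∈ xs ++ zs) →
                  lookup (++⁺ (++⁺ as bs) ρ) (embedˡ xs ys v) ≡ lookup (++⁺ as ρ) v
  lookup-embedˡ [] bs ρ v = lookup-∈-++⁺ʳ bs ρ v
  lookup-embedˡ (a ∷ as) bs ρ (here refl) = refl
  lookup-embedˡ (a ∷ as) bs ρ (there v) = lookup-embedˡ as bs ρ v

  lookup-embedʳ : {x : A} {xs ys zs : List A} (as : All P xs) (bs : All P ys) (ρ : All P zs) (v : x ∈ ys ++ zs) →
                  lookup (++⁺ (++⁺ as bs) ρ) (embedʳ xs v) ≡ lookup (++⁺ bs ρ) v
  lookup-embedʳ [] bs ρ v = refl
  lookup-embedʳ (a ∷ as) bs ρ v = lookup-embedʳ as bs ρ v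

  lookup-tabulate : {x : A} {xs : List A} (f : ∀ {x} → x ∈ xs → P x) (v : x ∈ xs) → lookup (All.tabulate f) v ≡ f v
  lookup-tabulate f (here refl) = refl
  lookup-tabulate f (there v) = lookup-tabulate (f ∘ there) v

  ++⁺-++⁻ : (xs : List A) {ys : List A} (as : All P (xs ++ ys)) → ++⁺ (++⁻ˡ xs as) (++⁻ʳ xs as) ≡ as
  ++⁺-++⁻ [] as = refl
  ++⁺-++⁻ (x ∷ xs) (a ∷ as) = cong (a ∷_) (++⁺-++⁻ xs as)

module Substitution (L : Language) where
  open FOL L

  variable
    Θ : Ctx

  infix 4 _≗ˢ_

  _≗ˢ_ : Sub Γ Δ → Sub Γ Δ → Set
  σ ≗ˢ τ = ∀ {s} (v : s ∈ _) → σ {s} v ≡ τ v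

  mutual
    subT-cong : {σ τ : Sub Γ Δ} → σ ≗ˢ τ → (u : Term Γ s) → subT σ u ≡ subT τ u
    subT-cong e (var v) = e v
    subT-cong e (app f us) = cong (app f) (subTs-cong e us)

    subTs-cong : {σ τ : Sub Γ Δ} → σ ≗ˢ τ → (us : Terms Γ ss) → subTs σ us ≡ subTs τ us
    subTs-cong e [] = refl
    subTs-cong e (u ∷ us) = cong₂ _∷_ (subT-cong e u) (subTs-cong e us)

  mutual
    subT-subT : (τ : Sub Δ Θ) (σ : Sub Γ Δ) (u : Term Γ s) → subT τ (subT σ u) ≡ subT (subT τ ∘ σ) u
    subT-subT τ σ (var v) = refl
    subT-subT τ σ (app f us) = cong (app f) (subTs-subTs τ σ us)

    subTs-subTs : (τ : Sub Δ Θ) (σ : Sub Γ Δ) (us : Terms Γ ss) → subTs τ (subTs σ us) ≡ subTs (subT τ ∘ σ) us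
    subTs-subTs τ σ [] = refl
    subTs-subTs τ σ (u ∷ us) = cong₂ _∷_ (subT-subT τ σ u) (subTs-subTs τ σ us)

  mutual
    subT-var : (u : Term Γ s) → subT var u ≡ u
    subT-var (var v) = refl
    subT-var (app f us) = cong (app f) (subTs-var us)

    subTs-var : (us : Terms Γ ss) → subTs var us ≡ us
    subTs-var [] = refl
    subTs-var (u ∷ us) = cong₂ _∷_ (subT-var u) (subTs-var us)

  mutual
    renT≡subT : (ρ : Ren Γ Δ) (u : Term Γ s) → renT ρ u ≡ subT (var ∘ ρ) u
    renT≡subT ρ (var v) = refl
    renT≡subT ρ (app f us) = cong (app f) (renTs≡subTs ρ us)

    renTs≡subTs : (ρ : Ren Γ Δ) (us : Terms Γ ss) → renTs ρ us ≡ subTs (var ∘ ρ) us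
    renTs≡subTs ρ [] = refl
    renTs≡subTs ρ (u ∷ us) = cong₂ _∷_ (renT≡subT ρ u) (renTs≡subTs ρ us)

  subT-σ₀-wk : (a : Term Γ t) (u : Term Γ s) → subT (σ₀ a) (renT there u) ≡ u
  subT-σ₀-wk a u = trans (cong (subT (σ₀ a)) (renT≡subT there u)) (trans (subT-subT (σ₀ a) (var ∘ there) u) (subT-var u))

  infixr 5 _∷ˢ_

  _∷ˢ_ : Term Δ s → Sub Γ Δ → Sub (s ∷ Γ) Δ
  (a ∷ˢ σ) (here refl) = a
  (a ∷ˢ σ) (there v) = σ v

  liftS-cong : {σ τ : Sub Γ Δ} → σ ≗ˢ τ → liftS {t = t} σ ≗ˢ liftS τ
  liftS-cong e (here p) = refl
  liftS-cong e (there v) = cong (renT there) (e v)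

  subF-cong : {σ τ : Sub Γ Δ} → σ ≗ˢ τ → (φ : Formula Γ) → subF σ φ ≡ subF τ φ
  subF-cong e (atom p us) = cong (atom p) (subTs-cong e us)
  subF-cong e (a ≐ b) = cong₂ _≐_ (subT-cong e a) (subT-cong e b)
  subF-cong e ⊥' = refl
  subF-cong e (φ ⇒ ψ) = cong₂ _⇒_ (subF-cong e φ) (subF-cong e ψ)
  subF-cong e (φ ∧' ψ) = cong₂ _∧'_ (subF-cong e φ) (subF-cong e ψ)
  subF-cong e (φ ∨' ψ) = cong₂ _∨'_ (subF-cong e φ) (subF-cong e ψ)
  subF-cong e (∀' s φ) = cong (∀' s) (subF-cong (liftS-cong e) φ)
  subF-cong e (∃' s φ) = cong (∃' s) (subF-cong (liftS-cong e) φ)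

  renT-subT : (ρ : Ren Δ Θ) (σ : Sub Γ Δ) (u : Term Γ s) → renT ρ (subT σ u) ≡ subT (renT ρ ∘ σ) u
  renT-subT ρ σ u = trans (renT≡subT ρ (subT σ u))
    (trans (subT-subT (var ∘ ρ) σ u) (subT-cong (λ v → sym (renT≡subT ρ (σ v))) u))

  liftS-subT : (τ : Sub Δ Θ) (σ : Sub Γ Δ) → subT (liftS {t = t} τ) ∘ liftS σ ≗ˢ liftS (subT τ ∘ σ)
  liftS-subT τ σ (here p) = refl
  liftS-subT τ σ (there v) = begin
    subT (liftS τ) (renT there (σ v))           ≡⟨ cong (subT (liftS τ)) (renT≡subT there (σ v)) ⟩
    subT (liftS τ) (subT (var ∘ there) (σ v))   ≡⟨ subT-subT (liftS τ) (var ∘ there) (σ v) ⟩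
    subT (renT there ∘ τ) (σ v)                 ≡⟨ renT-subT there τ (σ v) ⟨
    renT there (subT τ (σ v))                   ∎
    where open ≡-Reasoning

  subF-subF : (τ : Sub Δ Θ) (σ : Sub Γ Δ) (φ : Formula Γ) → subF τ (subF σ φ) ≡ subF (subT τ ∘ σ) φ
  subF-subF τ σ (atom p us) = cong (atom p) (subTs-subTs τ σ us)
  subF-subF τ σ (a ≐ b) = cong₂ _≐_ (subT-subT τ σ a) (subT-subT τ σ b)
  subF-subF τ σ ⊥' = refl
  subF-subF τ σ (φ ⇒ ψ) = cong₂ _⇒_ (subF-subF τ σ φ) (subF-subF τ σ ψ)
  subF-subF τ σ (φ ∧' ψ) = cong₂ _∧'_ (subF-subF τ σ φ) (subF-subF τ σ ψ)
  subF-subF τ σ (φ ∨' ψ) = cong₂ _∨'_ (subF-subF τ σ φ) (subF-subF τ σ ψ)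
  subF-subF τ σ (∀' s φ) = cong (∀' s) (trans (subF-subF (liftS τ) (liftS σ) φ) (subF-cong (liftS-subT τ σ) φ))
  subF-subF τ σ (∃' s φ) = cong (∃' s) (trans (subF-subF (liftS τ) (liftS σ) φ) (subF-cong (liftS-subT τ σ) φ))

  subF-liftS-[] : (σ : Sub Γ Δ) (a : Term Δ s) (φ : Formula (s ∷ Γ)) → subF (liftS σ) φ [ a ] ≡ subF (a ∷ˢ σ) φ
  subF-liftS-[] σ a φ = trans (subF-subF (σ₀ a) (liftS σ) φ) (subF-cong instantiate φ)
    where
      instantiate : subT (σ₀ a) ∘ liftS σ ≗ˢ a ∷ˢ σ
      instantiate (here refl) = refl
      instantiate (there v) = subT-σ₀-wk a (σ v)

  liftS-var : liftS {t = t} (var {Γ = Γ}) ≗ˢ var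
  liftS-var (here p) = refl
  liftS-var (there v) = refl

  subF-var : (φ : Formula Γ) → subF var φ ≡ φ
  subF-var (atom p us) = cong (atom p) (subTs-var us)
  subF-var (a ≐ b) = cong₂ _≐_ (subT-var a) (subT-var b)
  subF-var ⊥' = refl
  subF-var (φ ⇒ ψ) = cong₂ _⇒_ (subF-var φ) (subF-var ψ)
  subF-var (φ ∧' ψ) = cong₂ _∧'_ (subF-var φ) (subF-var ψ)
  subF-var (φ ∨' ψ) = cong₂ _∨'_ (subF-var φ) (subF-var ψ)
  subF-var (∀' s φ) = cong (∀' s) (trans (subF-cong liftS-var φ) (subF-var φ))
  subF-var (∃' s φ) = cong (∃' s) (trans (subF-cong liftS-var φ) (subF-var φ))

  liftR≗liftS : (ρ : Ren Γ Δ) → var ∘ liftR {t = t} ρ ≗ˢ liftS (var ∘ ρ)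
  liftR≗liftS ρ (here p) = refl
  liftR≗liftS ρ (there v) = refl

  renF≡subF : (ρ : Ren Γ Δ) (φ : Formula Γ) → renF ρ φ ≡ subF (var ∘ ρ) φ
  renF≡subF ρ (atom p us) = cong (atom p) (renTs≡subTs ρ us)
  renF≡subF ρ (a ≐ b) = cong₂ _≐_ (renT≡subT ρ a) (renT≡subT ρ b)
  renF≡subF ρ ⊥' = refl
  renF≡subF ρ (φ ⇒ ψ) = cong₂ _⇒_ (renF≡subF ρ φ) (renF≡subF ρ ψ)
  renF≡subF ρ (φ ∧' ψ) = cong₂ _∧'_ (renF≡subF ρ φ) (renF≡subF ρ ψ)
  renF≡subF ρ (φ ∨' ψ) = cong₂ _∨'_ (renF≡subF ρ φ) (renF≡subF ρ ψ)
  renF≡subF ρ (∀' s φ) = cong (∀' s) (trans (renF≡subF (liftR ρ) φ) (subF-cong (liftR≗liftS ρ) φ))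
  renF≡subF ρ (∃' s φ) = cong (∃' s) (trans (renF≡subF (liftR ρ) φ) (subF-cong (liftR≗liftS ρ) φ))

  only : Term Γ s → Sub (s ∷ []) Γ
  only u (here refl) = u

  _⟨_⟩ : Formula (s ∷ []) → Term Γ s → Formula Γ
  φ ⟨ u ⟩ = subF (only u) φ

  subF-only : (σ : Sub (s ∷ []) Γ) (φ : Formula (s ∷ [])) → subF σ φ ≡ φ ⟨ σ (here refl) ⟩
  subF-only σ = subF-cong λ { (here refl) → refl }

  liftS* : (ys : Ctx) → Sub Γ Δ → Sub (ys ++ Γ) (ys ++ Δ)
  liftS* [] σ = σ
  liftS* (y ∷ ys) σ = liftS (liftS* ys σ)

  subF-∃* : (ys : Ctx) (σ : Sub Γ Δ) (φ : Formula (ys ++ Γ)) → subF σ (∃* ys φ) ≡ ∃* ys (subF (liftS* ys σ) φ)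
  subF-∃* [] σ φ = refl
  subF-∃* (y ∷ ys) σ φ = subF-∃* ys σ (∃' y φ)

  subF-renF : (σ : Sub Δ Θ) (ρ : Ren Γ Δ) (φ : Formula Γ) → subF σ (renF ρ φ) ≡ subF (σ ∘ ρ) φ
  subF-renF σ ρ φ = trans (cong (subF σ) (renF≡subF ρ φ)) (subF-subF σ (var ∘ ρ) φ)

  renF-subF : (ρ : Ren Δ Θ) (σ : Sub Γ Δ) (φ : Formula Γ) → renF ρ (subF σ φ) ≡ subF (renT ρ ∘ σ) φ
  renF-subF ρ σ φ = trans (renF≡subF ρ (subF σ φ))
    (trans (subF-subF (var ∘ ρ) σ φ) (subF-cong (λ v → sym (renT≡subT ρ (σ v))) φ))

  renF-renF : (π : Ren Δ Θ) (ρ : Ren Γ Δ) (φ : Formula Γ) → renF π (renF ρ φ) ≡ renF (π ∘ ρ) φ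
  renF-renF π ρ φ = trans (renF≡subF π (renF ρ φ))
    (trans (subF-renF (var ∘ π) ρ φ) (sym (renF≡subF (π ∘ ρ) φ)))

module Semantics (L : Language) where
  open FOL L
  open Substitution L

  ≡⇒⇔ : {A B : Set} → A ≡ B → A ⇔ B
  ≡⇒⇔ = Related.≡⇒ {k = equivalence}

  module _ (M : Structure) where
    open Structure M

    Agree : Sub Γ Δ → Assignment M Δ → Assignment M Γ → Set
    Agree σ ρ ρ′ = ∀ {s} (v : s ∈ _) → lookup ρ′ v ≡ evalT M ρ (σ {s} v)

    mutual
      evalT-subT : {σ : Sub Γ Δ} {ρ : Assignment M Δ} {ρ′ : Assignment M Γ} → Agree σ ρ ρ′ →
                   (u : Term Γ s) → evalT M ρ (subT σ u) ≡ evalT M ρ′ u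
      evalT-subT ag (var v) = sym (ag v)
      evalT-subT ag (app f us) = cong (funᴵ f) (evalTs-subTs ag us)

      evalTs-subTs : {σ : Sub Γ Δ} {ρ : Assignment M Δ} {ρ′ : Assignment M Γ} → Agree σ ρ ρ′ →
                     (us : Terms Γ ss) → evalTs M ρ (subTs σ us) ≡ evalTs M ρ′ us
      evalTs-subTs ag [] = refl
      evalTs-subTs ag (u ∷ us) = cong₂ _∷_ (evalT-subT ag u) (evalTs-subTs ag us)

    evalT-wk : (a : Carrier t) (ρ : Assignment M Γ) (u : Term Γ s) → evalT M (a ∷ ρ) (renT there u) ≡ evalT M ρ u
    evalT-wk a ρ u = trans (cong (evalT M (a ∷ ρ)) (renT≡subT there u)) (evalT-subT (λ v → refl) u)

    Agree-liftS : {σ : Sub Γ Δ} {ρ : Assignment M Δ} {ρ′ : Assignment M Γ} (a : Carrier t) →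
                  Agree σ ρ ρ′ → Agree (liftS σ) (a ∷ ρ) (a ∷ ρ′)
    Agree-liftS a ag (here refl) = refl
    Agree-liftS {σ = σ} {ρ} a ag (there v) = trans (ag v) (sym (evalT-wk a ρ (σ v)))

    sat-subF : {σ : Sub Γ Δ} {ρ : Assignment M Δ} {ρ′ : Assignment M Γ} → Agree σ ρ ρ′ →
               (φ : Formula Γ) → Sat M ρ (subF σ φ) ⇔ Sat M ρ′ φ
    sat-subF ag (atom p us) = ≡⇒⇔ (cong (predᴵ p) (evalTs-subTs ag us))
    sat-subF ag (a ≐ b) = ≡⇒⇔ (cong₂ _≡_ (evalT-subT ag a) (evalT-subT ag b))
    sat-subF ag ⊥' = ⇔-refl
    sat-subF ag (φ ⇒ ψ) = →-cong-⇔ (sat-subF ag φ) (sat-subF ag ψ)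
    sat-subF ag (φ ∧' ψ) = sat-subF ag φ ×-⇔ sat-subF ag ψ
    sat-subF ag (φ ∨' ψ) = sat-subF ag φ ⊎-⇔ sat-subF ag ψ
    sat-subF ag (∀' s φ) = mk⇔ (λ h a → to (sat-subF (Agree-liftS a ag) φ) (h a))
                               (λ h a → from (sat-subF (Agree-liftS a ag) φ) (h a))
    sat-subF ag (∃' s φ) = mk⇔ (λ (a , h) → a , to (sat-subF (Agree-liftS a ag) φ) h)
                               (λ (a , h) → a , from (sat-subF (Agree-liftS a ag) φ) h)

    sat-renF : {π : Ren Γ Δ} {ρ : Assignment M Δ} {ρ′ : Assignment M Γ} →
               (∀ {s} (v : s ∈ Γ) → lookup ρ′ v ≡ lookup ρ (π v)) →
               (φ : Formula Γ) → Sat M ρ (renF π φ) ⇔ Sat M ρ′ φ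
    sat-renF {π = π} ag φ rewrite renF≡subF π φ = sat-subF ag φ

    sat-⟨⟩ : (ρ : Assignment M Γ) (u : Term Γ s) (φ : Formula (s ∷ [])) →
             Sat M ρ (φ ⟨ u ⟩) ⇔ Sat M (evalT M ρ u ∷ []) φ
    sat-⟨⟩ ρ u = sat-subF λ { (here refl) → refl }

    sat-∀* : (vs : Ctx) (ρ : Assignment M Γ) (φ : Formula (vs ++ Γ)) →
             Sat M ρ (∀* vs φ) ⇔ ((as : All Carrier vs) → Sat M (++⁺ as ρ) φ)
    sat-∀* [] ρ φ = mk⇔ (λ h → λ { [] → h }) (λ h → h [])
    sat-∀* (v ∷ vs) ρ φ = mk⇔ (λ h → λ { (a ∷ as) → to (sat-∀* vs ρ (∀' v φ)) h as a })
                              (λ h → from (sat-∀* vs ρ (∀' v φ)) (λ as a → h (a ∷ as)))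

    sat-∃* : (vs : Ctx) (ρ : Assignment M Γ) (φ : Formula (vs ++ Γ)) →
             Sat M ρ (∃* vs φ) ⇔ Σ (All Carrier vs) (λ as → Sat M (++⁺ as ρ) φ)
    sat-∃* [] ρ φ = mk⇔ ([] ,_) (λ { ([] , h) → h })
    sat-∃* (v ∷ vs) ρ φ = mk⇔ (λ h → let (as , a , k) = to (sat-∃* vs ρ (∃' v φ)) h in a ∷ as , k)
                              (λ { (a ∷ as , k) → from (sat-∃* vs ρ (∃' v φ)) (as , a , k) })

    sat-⋀ : (ρ : Assignment M Γ) (φs : List (Formula Γ)) → Sat M ρ (⋀ φs) ⇔ All (Sat M ρ) φs
    sat-⋀ ρ [] = mk⇔ (λ _ → []) (λ _ → λ ())
    sat-⋀ ρ (φ ∷ []) = mk⇔ (_∷ []) (λ { (h ∷ []) → h })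
    sat-⋀ ρ (φ ∷ φs@(_ ∷ _)) = mk⇔ (λ (h , k) → h ∷ to (sat-⋀ ρ φs) k)
                                   (λ hs → All.head hs , from (sat-⋀ ρ φs) (All.tail hs))

module Derivations (L : Language) where
  open FOL L
  open Substitution L

  variable
    Hs Hs′ : List (Formula Γ)
    φ χ : Formula Γ

  weaken : Hs ⊆ Hs′ → Hs ⊢[ Γ ] φ → Hs′ ⊢[ Γ ] φ
  weaken i (hyp x) = hyp (i x)
  weaken i (⊥E d) = ⊥E (weaken i d)
  weaken i (raa d) = raa (weaken (⊆.∷⁺ʳ _ i) d)
  weaken i (⇒I d) = ⇒I (weaken (⊆.∷⁺ʳ _ i) d)
  weaken i (⇒E d e) = ⇒E (weaken i d) (weaken i e)
  weaken i (∧I d e) = ∧I (weaken i d) (weaken i e)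
  weaken i (∧E₁ d) = ∧E₁ (weaken i d)
  weaken i (∧E₂ d) = ∧E₂ (weaken i d)
  weaken i (∨I₁ d) = ∨I₁ (weaken i d)
  weaken i (∨I₂ d) = ∨I₂ (weaken i d)
  weaken i (∨E d e f) = ∨E (weaken i d) (weaken (⊆.∷⁺ʳ _ i) e) (weaken (⊆.∷⁺ʳ _ i) f)
  weaken i (∀I d) = ∀I (weaken (⊆.map⁺ wk i) d)
  weaken i (∀E d u) = ∀E (weaken i d) u
  weaken i (∃I u d) = ∃I u (weaken i d)
  weaken i (∃E d e) = ∃E (weaken i d) (weaken (⊆.∷⁺ʳ _ (⊆.map⁺ wk i)) e)
  weaken i (≐refl u) = ≐refl u
  weaken i (≐E φ d e) = ≐E φ (weaken i d) (weaken i e)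

  cut : Hs ⊢[ Γ ] φ → (φ ∷ Hs) ⊢[ Γ ] χ → Hs ⊢[ Γ ] χ
  cut φ′ χ′ = ⇒E (⇒I χ′) φ′

  weaken-∷ : Hs ⊢[ Γ ] φ → (χ ∷ Hs) ⊢[ Γ ] φ
  weaken-∷ = weaken there

  ≐-sym : {Hs : List (Formula Γ)} {a b : Term Γ s} → Hs ⊢[ Γ ] a ≐ b → Hs ⊢[ Γ ] b ≐ a
  ≐-sym {Γ = Γ} {Hs = Hs} {a = a} ab = subst (Hs ⊢[ Γ ]_) (cong (_ ≐_) (subT-σ₀-wk _ a))
    (≐E (var (here refl) ≐ renT there a) ab (subst (Hs ⊢[ Γ ]_) (cong (a ≐_) (sym (subT-σ₀-wk a a))) (≐refl a)))

  ≐-trans : {Hs : List (Formula Γ)} {a b c : Term Γ s} → Hs ⊢[ Γ ] a ≐ b → Hs ⊢[ Γ ] b ≐ c → Hs ⊢[ Γ ] a ≐ c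
  ≐-trans {Γ = Γ} {Hs = Hs} {a = a} {b} {c} ab bc = subst (Hs ⊢[ Γ ]_) (cong (_≐ c) (subT-σ₀-wk c a))
    (≐E (renT there a ≐ var (here refl)) bc (subst (Hs ⊢[ Γ ]_) (cong (_≐ b) (sym (subT-σ₀-wk b a))) ab))

  renF-id : (φ : Formula Γ) → renF (λ v → v) φ ≡ φ
  renF-id φ = trans (renF≡subF (λ v → v) φ) (subF-var φ)

  ∃*-elim : (ys : Ctx) {φ : Formula (ys ++ Γ)} → Hs ⊢[ Γ ] ∃* ys φ →
            (φ ∷ map (renF (∈-++⁺ʳ ys)) Hs) ⊢[ ys ++ Γ ] renF (∈-++⁺ʳ ys) χ → Hs ⊢[ Γ ] χ
  ∃*-elim {Hs = Hs} {χ = χ} [] {φ} h d =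
    cut h (subst₂ (λ Hs′ χ′ → (φ ∷ Hs′) ⊢[ _ ] χ′) (trans (map-cong renF-id Hs) (map-id Hs)) (renF-id χ) d)
  ∃*-elim {Hs = Hs} {χ = χ} (y ∷ ys) {φ} h d = ∃*-elim ys h (∃E (hyp (here refl)) (weaken (⊆.∷⁺ʳ φ there) d′))
    where
      wk-renF : (φ : Formula _) → renF (∈-++⁺ʳ (y ∷ ys)) φ ≡ wk (renF (∈-++⁺ʳ ys) φ)
      wk-renF φ = sym (renF-renF there (∈-++⁺ʳ ys) φ)
      d′ : (φ ∷ map wk (map (renF (∈-++⁺ʳ ys)) Hs)) ⊢[ y ∷ ys ++ _ ] wk (renF (∈-++⁺ʳ ys) χ)
      d′ = subst₂ (λ Hs′ χ′ → (φ ∷ Hs′) ⊢[ _ ] χ′) (trans (map-cong wk-renF Hs) (map-∘ Hs)) (wk-renF χ) d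

module Fragments (L : Language) where
  open FOL L
  open Substitution L

  data Existential {Γ : Ctx} : Formula Γ → Set where
    qf : {φ : Formula Γ} → QuantifierFree φ → Existential φ
    ∃' : {φ : Formula (s ∷ Γ)} → Existential φ → Existential (∃' s φ)

  data Universal {Γ : Ctx} : Formula Γ → Set where
    qf   : {φ : Formula Γ} → QuantifierFree φ → Universal φ
    _∧'_ : {φ ψ : Formula Γ} → Universal φ → Universal ψ → Universal (φ ∧' ψ)
    ∀'   : {φ : Formula (s ∷ Γ)} → Universal φ → Universal (∀' s φ)
    ¬∃   : {φ : Formula Γ} → Existential φ → Universal (¬' φ)

  QuantifierFree-subF : (σ : Sub Γ Δ) {φ : Formula Γ} → QuantifierFree φ → QuantifierFree (subF σ φ)
  QuantifierFree-subF σ (atom p us) = atom p _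
  QuantifierFree-subF σ (eq a b) = eq _ _
  QuantifierFree-subF σ bot = bot
  QuantifierFree-subF σ (imp q r) = imp (QuantifierFree-subF σ q) (QuantifierFree-subF σ r)
  QuantifierFree-subF σ (and q r) = and (QuantifierFree-subF σ q) (QuantifierFree-subF σ r)
  QuantifierFree-subF σ (or q r) = or (QuantifierFree-subF σ q) (QuantifierFree-subF σ r)

  Existential-subF : (σ : Sub Γ Δ) {φ : Formula Γ} → Existential φ → Existential (subF σ φ)
  Existential-subF σ (qf q) = qf (QuantifierFree-subF σ q)
  Existential-subF σ (∃' e) = ∃' (Existential-subF (liftS σ) e)

  Universal-subF : (σ : Sub Γ Δ) {φ : Formula Γ} → Universal φ → Universal (subF σ φ)
  Universal-subF σ (qf q) = qf (QuantifierFree-subF σ q)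
  Universal-subF σ (u ∧' v) = Universal-subF σ u ∧' Universal-subF σ v
  Universal-subF σ (∀' u) = ∀' (Universal-subF (liftS σ) u)
  Universal-subF σ (¬∃ e) = ¬∃ (Existential-subF σ e)

  QuantifierFree-renF : (ρ : Ren Γ Δ) {φ : Formula Γ} → QuantifierFree φ → QuantifierFree (renF ρ φ)
  QuantifierFree-renF ρ {φ} q = subst QuantifierFree (sym (renF≡subF ρ φ)) (QuantifierFree-subF (var ∘ ρ) q)

  Universal-renF : (ρ : Ren Γ Δ) {φ : Formula Γ} → Universal φ → Universal (renF ρ φ)
  Universal-renF ρ {φ} u = subst Universal (sym (renF≡subF ρ φ)) (Universal-subF (var ∘ ρ) u)

  Existential-∃* : (vs : Ctx) {φ : Formula (vs ++ Γ)} → Existential φ → Existential (∃* vs φ)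
  Existential-∃* [] e = e
  Existential-∃* (v ∷ vs) e = Existential-∃* vs (∃' e)

  Universal-∀* : (vs : Ctx) {φ : Formula (vs ++ Γ)} → Universal φ → Universal (∀* vs φ)
  Universal-∀* [] u = u
  Universal-∀* (v ∷ vs) u = Universal-∀* vs (∀' u)

  Universal-⋀ : {φs : List (Formula Γ)} → All Universal φs → Universal (⋀ φs)
  Universal-⋀ [] = qf (imp bot bot)
  Universal-⋀ (u ∷ []) = u
  Universal-⋀ (u ∷ us@(_ ∷ _)) = u ∧' Universal-⋀ us

  QuantifierFree-⋁ : {φs : List (Formula Γ)} → All QuantifierFree φs → QuantifierFree (⋁ φs)
  QuantifierFree-⋁ [] = bot
  QuantifierFree-⋁ (q ∷ []) = q
  QuantifierFree-⋁ (q ∷ qs@(_ ∷ _)) = or q (QuantifierFree-⋁ qs)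

  QuantifierFree-litF : (l : Literal Γ) → QuantifierFree (litF l)
  QuantifierFree-litF (pos (atom p us)) = atom p us
  QuantifierFree-litF (pos (a ≐ b)) = eq a b
  QuantifierFree-litF (neg (atom p us)) = imp (atom p us) bot
  QuantifierFree-litF (neg (a ≐ b)) = imp (eq a b) bot

module PrenexClauseSets (L : Language) where
  open FOL L
  open Substitution L
  open Semantics L
  open Fragments L

  matrix : (c : Clause Γ) → Formula (Clause.vars c ++ Γ)
  matrix (clause vs ls) = ⋁ (map litF ls)

  QuantifierFree-matrix : (c : Clause Γ) → QuantifierFree (matrix c)
  QuantifierFree-matrix (clause vs ls) = QuantifierFree-⋁ (map⁺ (All.universal QuantifierFree-litF ls))

  Universal-clauseSetF : (S : ClauseSet Γ) → Universal (clauseSetF S)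
  Universal-clauseSetF S =
    Universal-⋀ (map⁺ (All.universal (λ c → Universal-∀* (Clause.vars c) (qf (QuantifierFree-matrix c))) S))

  clauseSetVars : ClauseSet Γ → Ctx
  clauseSetVars [] = []
  clauseSetVars (c ∷ S) = Clause.vars c ++ clauseSetVars S

  -- The variables of distinct clauses are kept apart.
  clauseSetMatrix : (S : ClauseSet Γ) → Formula (clauseSetVars S ++ Γ)
  clauseSetMatrix [] = ⊤'
  clauseSetMatrix (c ∷ S) =
    renF (embedˡ (Clause.vars c) (clauseSetVars S)) (matrix c) ∧' renF (embedʳ (Clause.vars c)) (clauseSetMatrix S)

  QuantifierFree-clauseSetMatrix : (S : ClauseSet Γ) → QuantifierFree (clauseSetMatrix S)
  QuantifierFree-clauseSetMatrix [] = imp bot bot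
  QuantifierFree-clauseSetMatrix (c ∷ S) =
    and (QuantifierFree-renF _ (QuantifierFree-matrix c)) (QuantifierFree-renF _ (QuantifierFree-clauseSetMatrix S))

  clauseSetNegation : ClauseSet Γ → Formula Γ
  clauseSetNegation S = ∃* (clauseSetVars S) (¬' (clauseSetMatrix S))

  module _ (M : Structure) where
    open Structure M

    sat-clauses : (S : ClauseSet Γ) (ρ : Assignment M Γ) →
                  All (Sat M ρ ∘ clauseF) S ⇔ ((as : All Carrier (clauseSetVars S)) → Sat M (++⁺ as ρ) (clauseSetMatrix S))
    sat-clauses [] ρ = mk⇔ (λ _ _ ()) (λ _ → [])
    sat-clauses (c ∷ S) ρ = mk⇔ prenex unprenex
      where
        vs ys : Ctx
        vs = Clause.vars c
        ys = clauseSetVars S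
        sat-clause : (as : All Carrier vs) (bs : All Carrier ys) →
                     Sat M (++⁺ (++⁺ as bs) ρ) (renF (embedˡ vs ys) (matrix c)) ⇔ Sat M (++⁺ as ρ) (matrix c)
        sat-clause as bs = sat-renF M (λ v → sym (lookup-embedˡ as bs ρ v)) (matrix c)
        sat-rest : (as : All Carrier vs) (bs : All Carrier ys) →
                   Sat M (++⁺ (++⁺ as bs) ρ) (renF (embedʳ vs) (clauseSetMatrix S)) ⇔ Sat M (++⁺ bs ρ) (clauseSetMatrix S)
        sat-rest as bs = sat-renF M (λ v → sym (lookup-embedʳ as bs ρ v)) (clauseSetMatrix S)
        prenex : All (Sat M ρ ∘ clauseF) (c ∷ S) →
                 (as : All Carrier (vs ++ ys)) → Sat M (++⁺ as ρ) (clauseSetMatrix (c ∷ S))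
        prenex (h ∷ hs) as = subst (λ as → Sat M (++⁺ as ρ) (clauseSetMatrix (c ∷ S))) (++⁺-++⁻ vs as)
          ( from (sat-clause (++⁻ˡ vs as) (++⁻ʳ vs as)) (to (sat-∀* M vs ρ (matrix c)) h (++⁻ˡ vs as))
          , from (sat-rest (++⁻ˡ vs as) (++⁻ʳ vs as)) (to (sat-clauses S ρ) hs (++⁻ʳ vs as)))
        unprenex : ((as : All Carrier (vs ++ ys)) → Sat M (++⁺ as ρ) (clauseSetMatrix (c ∷ S))) →
                   All (Sat M ρ ∘ clauseF) (c ∷ S)
        unprenex h = from (sat-∀* M vs ρ (matrix c)) (λ as → to (sat-clause as arbitrary) (proj₁ (h (++⁺ as arbitrary))))
                   ∷ from (sat-clauses S ρ) (λ bs → to (sat-rest arbitrary bs) (proj₂ (h (++⁺ arbitrary bs))))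
          where
            arbitrary : {xs : Ctx} → All Carrier xs
            arbitrary = All.universal inhabited _

    sat-clauseSetF : (S : ClauseSet Γ) (ρ : Assignment M Γ) →
                     Sat M ρ (clauseSetF S) ⇔ ((as : All Carrier (clauseSetVars S)) → Sat M (++⁺ as ρ) (clauseSetMatrix S))
    sat-clauseSetF S ρ = ⇔-trans (sat-⋀ M ρ (map clauseF S)) (⇔-trans (mk⇔ map⁻ map⁺) (sat-clauses S ρ))

    sat-clauseSetNegation : ExcludedMiddle 0ℓ → (S : ClauseSet Γ) (ρ : Assignment M Γ) →
                            Sat M ρ (clauseSetNegation S) ⇔ (¬ Sat M ρ (clauseSetF S))
    sat-clauseSetNegation em S ρ = mk⇔
      (λ h sat → let (as , ¬N) = to (sat-∃* M ys ρ _) h in ¬N (to (sat-clauseSetF S ρ) sat as))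
      (λ ¬sat → dne λ ¬h → ¬sat (from (sat-clauseSetF S ρ) λ as → dne λ ¬N → ¬h (from (sat-∃* M ys ρ _) (as , ¬N))))
      where
        ys : Ctx
        ys = clauseSetVars S
        dne : DoubleNegationElimination 0ℓ
        dne = em⇒dne em

module Completeness (L : Language) (em : ExcludedMiddle 0ℓ) where
  open FOL L
  open Substitution L
  open Semantics L
  open Derivations L
  open Fragments L

  data Symbol : Set where
    fun  : Fun ss s → Symbol
    pred : Pred ss → Symbol

  mutual
    symbolsT : Term Δ s → List Symbol
    symbolsT (var v) = []
    symbolsT (app f us) = fun f ∷ symbolsTs us

    symbolsTs : Terms Δ ss → List Symbol
    symbolsTs [] = []
    symbolsTs (u ∷ us) = symbolsT u ++ symbolsTs us

  symbols : Formula Δ → List Symbol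
  symbols (atom p us) = pred p ∷ symbolsTs us
  symbols (a ≐ b) = symbolsT a ++ symbolsT b
  symbols ⊥' = []
  symbols (φ ⇒ ψ) = symbols φ ++ symbols ψ
  symbols (φ ∧' ψ) = symbols φ ++ symbols ψ
  symbols (φ ∨' ψ) = symbols φ ++ symbols ψ
  symbols (∀' s φ) = symbols φ
  symbols (∃' s φ) = symbols φ

  occurrences : (Δ : Ctx) (s : Sort) → List (s ∈ Δ)
  occurrences [] s = []
  occurrences (u ∷ Δ) s with s ≟ u
  ... | yes p = here p ∷ map there (occurrences Δ s)
  ... | no _ = map there (occurrences Δ s)

  ∈-occurrences : (v : s ∈ Δ) → v ∈ occurrences Δ s
  ∈-occurrences {s} (here {x = u} refl) with s ≟ u
  ... | yes refl = here refl
  ... | no s≢s = contradiction refl s≢s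
  ∈-occurrences {s} (there {x = u} v) with s ≟ u
  ... | yes _ = there (∈-map⁺ there (∈-occurrences v))
  ... | no _ = ∈-map⁺ there (∈-occurrences v)

  first : {A : Set} → (A → Set) → A → List A → A
  first Q a [] = a
  first Q a (x ∷ xs) with em {Q x}
  ... | yes _ = x
  ... | no _ = first Q a xs

  module _ {A : Set} {Q : A → Set} {a : A} where

    first-satisfies : {xs : List A} → Any Q xs → Q (first Q a xs)
    first-satisfies {x ∷ xs} q with em {Q x}
    ... | yes qx = qx
    first-satisfies {x ∷ xs} (here qx) | no ¬qx = contradiction qx ¬qx
    first-satisfies {x ∷ xs} (there q) | no ¬qx = first-satisfies q

    first-∈ : {xs : List A} → Any Q xs → first Q a xs ∈ xs
    first-∈ {x ∷ xs} q with em {Q x}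
    ... | yes _ = here refl
    first-∈ {x ∷ xs} (here qx) | no ¬qx = contradiction qx ¬qx
    first-∈ {x ∷ xs} (there q) | no ¬qx = there (first-∈ q)

    first-++ : {xs : List A} (ys : List A) → Any Q xs → first Q a (xs ++ ys) ≡ first Q a xs
    first-++ {x ∷ xs} ys q with em {Q x}
    ... | yes _ = refl
    first-++ {x ∷ xs} ys (here qx) | no ¬qx = contradiction qx ¬qx
    first-++ {x ∷ xs} ys (there q) | no ¬qx = first-++ ys q

    first-cong : {R : A → Set} {b : A} {xs : List A} → (∀ {x} → Q x ⇔ R x) → Any Q xs → first Q a xs ≡ first R b xs
    first-cong {R = R} {xs = x ∷ xs} Q⇔R q with em {Q x} | em {R x}
    ... | yes _ | yes _ = refl
    ... | yes qx | no ¬rx = contradiction (to Q⇔R qx) ¬rx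
    ... | no ¬qx | yes rx = contradiction (from Q⇔R rx) ¬qx
    first-cong {R = R} {xs = x ∷ xs} Q⇔R (here qx) | no ¬qx | no _ = contradiction qx ¬qx
    first-cong {R = R} {xs = x ∷ xs} Q⇔R (there q) | no _ | no _ = first-cong Q⇔R q

  module TermModel (Γ : Ctx) (inh : ∀ s → s ∈ Γ) (H0 : List (Formula Γ)) (consistent : ¬ (H0 ⊢[ Γ ] ⊥')) where

    signature : List Symbol
    signature = concatMap symbols H0

    -- level d s: the terms of sort s and depth ≤ d over the variables of Γ and the symbols of H0
    mutual
      level : ℕ → (s : Sort) → List (Term Γ s)
      level zero s = map var (occurrences Γ s)
      level (suc d) s = level d s ++ concatMap (applications d s) signature

      applications : ℕ → (s : Sort) → Symbol → List (Term Γ s)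
      applications d s (fun {ss} {u} f) with u ≟ s
      ... | yes refl = map (app f) (tuples d ss)
      ... | no _ = []
      applications d s (pred p) = []

      tuples : ℕ → (ss : List Sort) → List (Terms Γ ss)
      tuples d [] = [] ∷ []
      tuples d (u ∷ ss) = cartesianProductWith _∷_ (level d u) (tuples d ss)

    level-prefix : {d e : ℕ} → d ≤′ e → Σ (List (Term Γ s)) λ zs → level e s ≡ level d s ++ zs
    level-prefix {d = d} ≤′-refl = [] , sym (++-identityʳ (level d _))
    level-prefix {s = s} {d} (≤′-step {e} d≤e) =
      let (zs , level-e) = level-prefix d≤e
      in zs ++ concatMap (applications e s) signature , trans (cong (_++ _) level-e) (++-assoc (level d s) zs _)

    level-mono : {d e : ℕ} {u : Term Γ s} → d ≤′ e → u ∈ level d s → u ∈ level e s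
    level-mono ≤′-refl m = m
    level-mono (≤′-step d≤e) m = ∈-++⁺ˡ (level-mono d≤e m)

    tuples-mono : {d e : ℕ} {us : Terms Γ ss} → d ≤′ e → us ∈ tuples d ss → us ∈ tuples e ss
    tuples-mono {us = []} d≤e m = here refl
    tuples-mono {ss = s ∷ ss} {d = d} {us = u ∷ us} d≤e m with ∈-cartesianProductWith⁻ _∷_ (level d s) (tuples d ss) m
    ... | _ , _ , u∈ , us∈ , refl = ∈-cartesianProductWith⁺ _∷_ (level-mono d≤e u∈) (tuples-mono d≤e us∈)

    Enumerated : Term Γ s → Set
    Enumerated {s} u = Σ ℕ λ d → u ∈ level d s

    var-enumerated : (v : s ∈ Γ) → Enumerated (var v)
    var-enumerated v = zero , ∈-map⁺ var (∈-occurrences v)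

    app-enumerated : {d : ℕ} (f : Fun ss s) {us : Terms Γ ss} → fun f ∈ signature → us ∈ tuples d ss → Enumerated (app f us)
    app-enumerated {s = s} {d} f {us} f∈ us∈ =
      suc d , ∈-++⁺ʳ (level d s) (∈-concat⁺′ app∈ (∈-map⁺ (applications d s) f∈))
      where
        app∈ : app f us ∈ applications d s (fun f)
        app∈ with s ≟ s
        ... | yes refl = ∈-map⁺ (app f) us∈
        ... | no s≢s = contradiction refl s≢s

    atoms : ℕ → List (Formula Γ)
    atoms d = concatMap predicateAtoms signature ++ concatMap equations (allFin numSorts)
      where
        predicateAtoms : Symbol → List (Formula Γ)
        predicateAtoms (fun f) = []
        predicateAtoms (pred {ss} p) = map (atom p) (tuples d ss)
        equations : Sort → List (Formula Γ)
        equations s = cartesianProductWith _≐_ (level d s) (level d s)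

    atom∈atoms : {d : ℕ} (p : Pred ss) {us : Terms Γ ss} → pred p ∈ signature → us ∈ tuples d ss → atom p us ∈ atoms d
    atom∈atoms p p∈ us∈ = ∈-++⁺ˡ (∈-concat⁺′ (∈-map⁺ (atom p) us∈) (∈-map⁺ _ p∈))

    ≐∈atoms : (d : ℕ) {a b : Term Γ s} → a ∈ level d s → b ∈ level d s → (a ≐ b) ∈ atoms d
    ≐∈atoms {s = s} d a∈ b∈ =
      ∈-++⁺ʳ _ (∈-concat⁺′ (∈-cartesianProductWith⁺ _≐_ a∈ b∈) (∈-map⁺ _ (∈-allFin s)))

    -- Lindenbaum chain: stage (suc d) decides every atom of atoms d.
    choice : Formula Γ → List (Formula Γ) → Formula Γ
    choice A H with em {(A ∷ H) ⊢[ Γ ] ⊥'}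
    ... | yes _ = ¬' A
    ... | no _ = A

    Decides : List (Formula Γ) → Formula Γ → Set
    Decides H A = (H ⊢[ Γ ] A) ⊎ (H ⊢[ Γ ] ¬' A)

    choice-consistent : {A : Formula Γ} {H : List (Formula Γ)} → ¬ (H ⊢[ Γ ] ⊥') → ¬ ((choice A H ∷ H) ⊢[ Γ ] ⊥')
    choice-consistent {A} {H} H⊬⊥ with em {(A ∷ H) ⊢[ Γ ] ⊥'}
    ... | yes A⊢⊥ = λ ¬A⊢⊥ → H⊬⊥ (cut (⇒I A⊢⊥) ¬A⊢⊥)
    ... | no A⊬⊥ = A⊬⊥

    choice-decides : (A : Formula Γ) (H : List (Formula Γ)) → Decides (choice A H ∷ H) A
    choice-decides A H with em {(A ∷ H) ⊢[ Γ ] ⊥'}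
    ... | yes _ = inj₂ (hyp (here refl))
    ... | no _ = inj₁ (hyp (here refl))

    extend : List (Formula Γ) → List (Formula Γ) → List (Formula Γ)
    extend [] H = H
    extend (A ∷ As) H = extend As (choice A H ∷ H)

    extend-⊇ : (As : List (Formula Γ)) {H : List (Formula Γ)} → H ⊆ extend As H
    extend-⊇ [] m = m
    extend-⊇ (A ∷ As) m = extend-⊇ As (there m)

    extend-consistent : (As : List (Formula Γ)) {H : List (Formula Γ)} → ¬ (H ⊢[ Γ ] ⊥') → ¬ (extend As H ⊢[ Γ ] ⊥')
    extend-consistent [] H⊬⊥ = H⊬⊥
    extend-consistent (A ∷ As) H⊬⊥ = extend-consistent As (choice-consistent H⊬⊥)

    extend-decides : {A : Formula Γ} (As : List (Formula Γ)) {H : List (Formula Γ)} → A ∈ As → Decides (extend As H) A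
    extend-decides (A ∷ As) {H} (here refl) = Sum.map (weaken (extend-⊇ As)) (weaken (extend-⊇ As)) (choice-decides A H)
    extend-decides (B ∷ As) (there m) = extend-decides As m

    stage : ℕ → List (Formula Γ)
    stage zero = H0
    stage (suc d) = extend (atoms d) (stage d)

    stage-mono : {d e : ℕ} → d ≤′ e → stage d ⊆ stage e
    stage-mono ≤′-refl m = m
    stage-mono (≤′-step {e} d≤e) m = extend-⊇ (atoms e) (stage-mono d≤e m)

    stage-consistent : (d : ℕ) → ¬ (stage d ⊢[ Γ ] ⊥')
    stage-consistent zero = consistent
    stage-consistent (suc d) = extend-consistent (atoms d) (stage-consistent d)

    Th : Formula Γ → Set
    Th φ = Σ ℕ λ d → stage d ⊢[ Γ ] φ

    Th-map : {φ ψ : Formula Γ} → (∀ {H} → H ⊢[ Γ ] φ → H ⊢[ Γ ] ψ) → Th φ → Th ψ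
    Th-map f (d , φ′) = d , f φ′

    Th-map₂ : {φ ψ χ : Formula Γ} → (∀ {H} → H ⊢[ Γ ] φ → H ⊢[ Γ ] ψ → H ⊢[ Γ ] χ) →
              Th φ → Th ψ → Th χ
    Th-map₂ f (d , φ′) (e , ψ′) =
      d ⊔ e , f (weaken (stage-mono (≤⇒≤′ (m≤m⊔n d e))) φ′) (weaken (stage-mono (≤⇒≤′ (m≤n⊔m d e))) ψ′)

    Th-excluded : {φ : Formula Γ} → Th φ → Th (¬' φ) → ⊥
    Th-excluded φ′ ¬φ′ =
      let (d , ⊥′) = Th-map₂ (λ φ″ ¬φ″ → ⇒E ¬φ″ φ″) φ′ ¬φ′ in stage-consistent d ⊥′

    Th-decides : {A : Formula Γ} {d : ℕ} → A ∈ atoms d → Th A ⊎ Th (¬' A)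
    Th-decides {d = d} m = Sum.map (suc d ,_) (suc d ,_) (extend-decides (atoms d) m)

    infix 4 _~_ _≈_

    _~_ : Term Γ s → Term Γ s → Set
    u ~ w = Th (u ≐ w)

    ~-refl : (u : Term Γ s) → u ~ u
    ~-refl u = zero , ≐refl u

    ~-sym : {u w : Term Γ s} → u ~ w → w ~ u
    ~-sym = Th-map ≐-sym

    ~-trans : {u w z : Term Γ s} → u ~ w → w ~ z → u ~ z
    ~-trans = Th-map₂ ≐-trans

    _≈_ : Terms Γ Δ → Terms Γ Δ → Set
    [] ≈ [] = ⊤
    (a ∷ as) ≈ (b ∷ bs) = a ~ b × as ≈ bs

    prefix : Terms Γ Δ → Sub (Δ ++ Γ) Γ
    prefix [] = var
    prefix (a ∷ as) = a ∷ˢ prefix as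

    prefix-∈-++⁺ʳ : (as : Terms Γ Δ) → prefix as ∘ ∈-++⁺ʳ Δ ≗ˢ var
    prefix-∈-++⁺ʳ [] v = refl
    prefix-∈-++⁺ʳ (a ∷ as) v = prefix-∈-++⁺ʳ as v

    subT-prefix-wk : (as : Terms Γ Δ) (u : Term Γ s) → subT (prefix as) (renT (∈-++⁺ʳ Δ) u) ≡ u
    subT-prefix-wk {Δ} as u = begin
      subT (prefix as) (renT (∈-++⁺ʳ Δ) u)          ≡⟨ cong (subT (prefix as)) (renT≡subT (∈-++⁺ʳ Δ) u) ⟩
      subT (prefix as) (subT (var ∘ ∈-++⁺ʳ Δ) u)    ≡⟨ subT-subT (prefix as) (var ∘ ∈-++⁺ʳ Δ) u ⟩
      subT (prefix as ∘ ∈-++⁺ʳ Δ) u                 ≡⟨ subT-cong (prefix-∈-++⁺ʳ as) u ⟩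
      subT var u                                    ≡⟨ subT-var u ⟩
      u                                             ∎
      where open ≡-Reasoning

    _∷ᵖ_ : Term Γ s → (Δ : Ctx) → Sub (s ∷ Δ ++ Γ) (Δ ++ Γ)
    b ∷ᵖ Δ = renT (∈-++⁺ʳ Δ) b ∷ˢ var

    subF-prefix-∷ : (φ : Formula (s ∷ Δ ++ Γ)) (b : Term Γ s) (as : Terms Γ Δ) →
                    subF (prefix as) (subF (b ∷ᵖ Δ) φ) ≡ subF (prefix (b ∷ as)) φ
    subF-prefix-∷ φ b as = trans (subF-subF (prefix as) (b ∷ᵖ _) φ) (subF-cong pointwise φ)
      where
        pointwise : subT (prefix as) ∘ (b ∷ᵖ _) ≗ˢ prefix (b ∷ as)
        pointwise (here refl) = subT-prefix-wk as b
        pointwise (there v) = refl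

    Th-≈ : (φ : Formula (Δ ++ Γ)) {as bs : Terms Γ Δ} → as ≈ bs → Th (subF (prefix as) φ) → Th (subF (prefix bs) φ)
    Th-≈ {[]} φ {[]} {[]} _ φ′ = φ′
    Th-≈ {s ∷ Δ} φ {a ∷ as} {b ∷ bs} (a~b , as≈bs) φ′ =
      subst Th (subF-prefix-∷ φ b bs) (Th-≈ (subF (b ∷ᵖ Δ) φ) as≈bs (subst Th (sym (subF-prefix-∷ φ b as)) replaced))
      where
        replaced : Th (subF (prefix (b ∷ as)) φ)
        replaced = subst Th (subF-liftS-[] (prefix as) b φ)
          (Th-map₂ (≐E (subF (liftS (prefix as)) φ)) a~b (subst Th (sym (subF-liftS-[] (prefix as) a φ)) φ′))

    ~-subT : (u : Term (Δ ++ Γ) s) {as bs : Terms Γ Δ} → as ≈ bs → subT (prefix as) u ~ subT (prefix bs) u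
    ~-subT {Δ = Δ} {s = s} u {as} {bs} as≈bs =
      subst (_~ subT (prefix bs) u) (subT-prefix-wk bs u₀)
        (Th-≈ (renT (∈-++⁺ʳ Δ) u₀ ≐ u) as≈bs (subst (_~ u₀) (sym (subT-prefix-wk as u₀)) (~-refl u₀)))
      where
        u₀ : Term Γ s
        u₀ = subT (prefix as) u

    variables : (Δ : Ctx) → Terms (Δ ++ Γ) Δ
    variables [] = []
    variables (s ∷ Δ) = var (here refl) ∷ renTs there (variables Δ)

    subTs-prefix-variables : (as : Terms Γ Δ) → subTs (prefix as) (variables Δ) ≡ as
    subTs-prefix-variables [] = refl
    subTs-prefix-variables {s ∷ Δ} (a ∷ as) = cong (a ∷_) (begin
      subTs (prefix (a ∷ as)) (renTs there (variables Δ))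
        ≡⟨ cong (subTs _) (renTs≡subTs there (variables Δ)) ⟩
      subTs (prefix (a ∷ as)) (subTs (var ∘ there) (variables Δ))
        ≡⟨ subTs-subTs (prefix (a ∷ as)) (var ∘ there) (variables Δ) ⟩
      subTs (prefix as) (variables Δ)
        ≡⟨ subTs-prefix-variables as ⟩
      as ∎)
      where open ≡-Reasoning

    app-cong : (f : Fun ss s) {as bs : Terms Γ ss} → as ≈ bs → app f as ~ app f bs
    app-cong {ss} f {as} {bs} as≈bs =
      subst₂ (λ as bs → app f as ~ app f bs) (subTs-prefix-variables as) (subTs-prefix-variables bs)
        (~-subT (app f (variables ss)) as≈bs)

    tabulateTs : (Δ : Ctx) → Sub Δ Γ → Terms Γ Δ
    tabulateTs [] σ = []
    tabulateTs (s ∷ Δ) σ = σ (here refl) ∷ tabulateTs Δ (σ ∘ there)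

    prefix-tabulateTs : (σ : Sub Δ Γ) → prefix (tabulateTs Δ σ) ∘ ∈-++⁺ˡ ≗ˢ σ
    prefix-tabulateTs {s ∷ Δ} σ (here refl) = refl
    prefix-tabulateTs {s ∷ Δ} σ (there v) = prefix-tabulateTs (σ ∘ there) v

    tabulateTs-≈ : {σ τ : Sub Δ Γ} → (∀ {s} (v : s ∈ Δ) → σ v ~ τ v) → tabulateTs Δ σ ≈ tabulateTs Δ τ
    tabulateTs-≈ {[]} σ~τ = _
    tabulateTs-≈ {s ∷ Δ} σ~τ = σ~τ (here refl) , tabulateTs-≈ (σ~τ ∘ there)

    Th-~ˢ : (φ : Formula Δ) {σ τ : Sub Δ Γ} → (∀ {s} (v : s ∈ Δ) → σ v ~ τ v) → Th (subF σ φ) → Th (subF τ φ)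
    Th-~ˢ {Δ} φ {σ} {τ} σ~τ =
      subst Th (in-front τ) ∘ Th-≈ (renF ∈-++⁺ˡ φ) (tabulateTs-≈ σ~τ) ∘ subst Th (sym (in-front σ))
      where
        in-front : (σ : Sub Δ Γ) → subF (prefix (tabulateTs Δ σ)) (renF ∈-++⁺ˡ φ) ≡ subF σ φ
        in-front σ = trans (subF-renF _ ∈-++⁺ˡ φ) (subF-cong (prefix-tabulateTs σ) φ)

    atom-cong : (p : Pred ss) {as bs : Terms Γ ss} → as ≈ bs → Th (atom p as) → Th (atom p bs)
    atom-cong {ss} p {as} {bs} as≈bs =
      subst (Th ∘ atom p) (subTs-prefix-variables bs)
      ∘ Th-≈ (atom p (variables ss)) as≈bs
      ∘ subst (Th ∘ atom p) (sym (subTs-prefix-variables as))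

    ¬atom-cong : (p : Pred ss) {as bs : Terms Γ ss} → as ≈ bs → Th (¬' (atom p as)) → Th (¬' (atom p bs))
    ¬atom-cong {ss} p {as} {bs} as≈bs =
      subst (Th ∘ ¬' ∘ atom p) (subTs-prefix-variables bs)
      ∘ Th-≈ (¬' (atom p (variables ss))) as≈bs
      ∘ subst (Th ∘ ¬' ∘ atom p) (sym (subTs-prefix-variables as))

    ¬≐-cong : {a b a′ b′ : Term Γ s} → a ~ a′ → b ~ b′ → Th (¬' (a ≐ b)) → Th (¬' (a′ ≐ b′))
    ¬≐-cong {s} {a} {b} {a′} {b′} a~a′ b~b′ =
      Th-≈ {s ∷ s ∷ []} (¬' (var (here refl) ≐ var (there (here refl))))
           {a ∷ b ∷ []} {a′ ∷ b′ ∷ []} (a~a′ , b~b′ , _)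

    default : (s : Sort) → Term Γ s
    default s = var (inh s)

    Witnessed : Term Γ s → Set
    Witnessed {s} u = Σ ℕ λ d → Any (_~ u) (level d s)

    Enumerated⇒Witnessed : {u : Term Γ s} → Enumerated u → Witnessed u
    Enumerated⇒Witnessed {u = u} (d , u∈) = d , Any.map (λ { refl → ~-refl u }) u∈

    Witnessed-~ : {u w : Term Γ s} → u ~ w → Witnessed u → Witnessed w
    Witnessed-~ u~w (d , x~u) = d , Any.map (λ x~u → ~-trans x~u u~w) x~u

    firstAt : ℕ → Term Γ s → Term Γ s
    firstAt {s} d u = first (_~ u) u (level d s)

    firstAt-mono : {d e : ℕ} {u : Term Γ s} → d ≤′ e → Any (_~ u) (level d s) → firstAt e u ≡ firstAt d u
    firstAt-mono {s} {d} {u = u} d≤e x~u with level-prefix {s = s} d≤e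
    ... | zs , level-e rewrite level-e = first-++ zs x~u

    -- Without quotient types, the class of u modulo ~ is represented by its first member in the enumeration.
    rep : Term Γ s → Term Γ s
    rep {s} u with em {Witnessed u}
    ... | yes (d , _) = firstAt d u
    ... | no _ = firstAt zero (default s)

    rep-at : (d : ℕ) {u : Term Γ s} → Any (_~ u) (level d s) → rep u ≡ firstAt d u
    rep-at d {u} x~u with em {Witnessed u}
    ... | yes (d′ , x~u′) =
      trans (sym (firstAt-mono (≤⇒≤′ (m≤n⊔m d d′)) x~u′)) (firstAt-mono (≤⇒≤′ (m≤m⊔n d d′)) x~u)
    ... | no ¬w = contradiction (d , x~u) ¬w

    rep-default : {u : Term Γ s} → ¬ Witnessed u → rep {s} u ≡ firstAt zero (default s)
    rep-default {u = u} ¬w with em {Witnessed u}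
    ... | yes w = contradiction w ¬w
    ... | no _ = refl

    default-witnessed : (s : Sort) → Any (_~ default s) (level zero s)
    default-witnessed s = proj₂ (Enumerated⇒Witnessed (var-enumerated (inh s)))

    rep-~ : {u : Term Γ s} → Witnessed u → rep u ~ u
    rep-~ (d , x~u) = subst (_~ _) (sym (rep-at d x~u)) (first-satisfies x~u)

    rep-cong : {u w : Term Γ s} → u ~ w → rep u ≡ rep w
    rep-cong {u = u} {w} u~w = by-cases (em {Witnessed u})
      where
        open ≡-Reasoning
        by-cases : Dec (Witnessed u) → rep u ≡ rep w
        by-cases (yes (d , x~u)) = begin
          rep u        ≡⟨ rep-at d x~u ⟩
          firstAt d u  ≡⟨ first-cong (mk⇔ (λ x~u → ~-trans x~u u~w) (λ x~w → ~-trans x~w (~-sym u~w))) x~u ⟩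
          firstAt d w  ≡⟨ rep-at d (proj₂ (Witnessed-~ u~w (d , x~u))) ⟨
          rep w        ∎
        by-cases (no ¬w) = trans (rep-default ¬w) (sym (rep-default (¬w ∘ Witnessed-~ (~-sym u~w))))

    rep-enumerated : (u : Term Γ s) → Enumerated (rep u)
    rep-enumerated {s} u with em {Witnessed u}
    ... | yes (d , x~u) = d , first-∈ x~u
    ... | no _ = zero , first-∈ (default-witnessed s)

    rep-idem : (u : Term Γ s) → rep (rep u) ≡ rep u
    rep-idem {s} u = by-cases (em {Witnessed u})
      where
        open ≡-Reasoning
        by-cases : Dec (Witnessed u) → rep (rep u) ≡ rep u
        by-cases (yes w) = rep-cong (rep-~ w)
        by-cases (no ¬w) = begin
          rep (rep u)                      ≡⟨ cong rep (rep-default ¬w) ⟩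
          rep (firstAt zero (default s))   ≡⟨ rep-cong (first-satisfies {xs = level zero s} (default-witnessed s)) ⟩
          rep (default s)                  ≡⟨ rep-at zero (default-witnessed s) ⟩
          firstAt zero (default s)         ≡⟨ rep-default ¬w ⟨
          rep u                            ∎

    Carrier : Sort → Set
    Carrier s = Σ (Term Γ s) λ u → rep u ≡ u

    canon : Term Γ s → Carrier s
    canon u = rep u , rep-idem u

    Carrier-≡ : {x y : Carrier s} → proj₁ x ≡ proj₁ y → x ≡ y
    Carrier-≡ {x = u , p} {.u , q} refl = cong (u ,_) (uip p q)

    Carrier-enumerated : (x : Carrier s) → Enumerated (proj₁ x)
    Carrier-enumerated (u , rep-u) = subst Enumerated rep-u (rep-enumerated u)

    termsOf : All Carrier ss → Terms Γ ss
    termsOf [] = []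
    termsOf (x ∷ xs) = proj₁ x ∷ termsOf xs

    termsOf-enumerated : (xs : All Carrier ss) → Σ ℕ λ d → termsOf xs ∈ tuples d ss
    termsOf-enumerated [] = zero , here refl
    termsOf-enumerated (x ∷ xs) =
      let (d , u∈) = Carrier-enumerated x ; (e , us∈) = termsOf-enumerated xs
      in d ⊔ e ,
         ∈-cartesianProductWith⁺ _∷_ (level-mono (≤⇒≤′ (m≤m⊔n d e)) u∈) (tuples-mono (≤⇒≤′ (m≤n⊔m d e)) us∈)

    Model : Structure
    Model = record
      { Carrier   = Carrier
      ; inhabited = canon ∘ default
      ; funᴵ      = λ f xs → canon (app f (termsOf xs))
      ; predᴵ     = λ p xs → Th (atom p (termsOf xs))
      }

    ⟦_⟧ : Assignment Model Δ → Sub Δ Γ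
    ⟦ ρ ⟧ v = proj₁ (lookup ρ v)

    mutual
      evalT-~ : (ρ : Assignment Model Δ) (u : Term Δ s) → symbolsT u ⊆ signature → proj₁ (evalT Model ρ u) ~ subT ⟦ ρ ⟧ u
      evalT-~ ρ (var v) _ = ~-refl _
      evalT-~ ρ (app {ss = ss} f us) f,us⊆ =
        ~-trans (rep-~ (Enumerated⇒Witnessed (app-enumerated f (f,us⊆ (here refl)) (proj₂ (termsOf-enumerated xs)))))
                (app-cong f (evalTs-≈ ρ us (f,us⊆ ∘ there)))
        where
          xs : All Carrier ss
          xs = evalTs Model ρ us

      evalTs-≈ : (ρ : Assignment Model Δ) (us : Terms Δ ss) → symbolsTs us ⊆ signature →
                 termsOf (evalTs Model ρ us) ≈ subTs ⟦ ρ ⟧ us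
      evalTs-≈ ρ [] _ = _
      evalTs-≈ ρ (u ∷ us) ⊆sig = evalT-~ ρ u (⊆-++⁻ˡ ⊆sig) , evalTs-≈ ρ us (⊆-++⁻ʳ (symbolsT u) ⊆sig)

    Decided : Set → Formula Γ → Set
    Decided P φ = (P → Th φ) × (¬ P → Th (¬' φ))

    module _ {P Q : Set} {φ ψ : Formula Γ} where

      decided-⇒ : Decided P φ → Decided Q ψ → Decided (P → Q) (φ ⇒ ψ)
      decided-⇒ (φ⁺ , φ⁻) (ψ⁺ , ψ⁻) = true , false
        where
          true : (P → Q) → Th (φ ⇒ ψ)
          true p→q with em {P}
          ... | yes p = Th-map (⇒I ∘ weaken-∷) (ψ⁺ (p→q p))
          ... | no ¬p = Th-map (λ ¬φ → ⇒I (⊥E (⇒E (weaken-∷ ¬φ) (hyp (here refl))))) (φ⁻ ¬p)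
          false : ¬ (P → Q) → Th (¬' (φ ⇒ ψ))
          false ¬p→q with em {P}
          ... | yes p = Th-map₂ (λ φ′ ¬ψ → ⇒I (⇒E (weaken-∷ ¬ψ) (⇒E (hyp (here refl)) (weaken-∷ φ′))))
                                (φ⁺ p) (ψ⁻ (λ q → ¬p→q (λ _ → q)))
          ... | no ¬p = contradiction (λ p → contradiction p ¬p) ¬p→q

      decided-∧ : Decided P φ → Decided Q ψ → Decided (P × Q) (φ ∧' ψ)
      decided-∧ (φ⁺ , φ⁻) (ψ⁺ , ψ⁻) = (λ (p , q) → Th-map₂ ∧I (φ⁺ p) (ψ⁺ q)) , false
        where
          false : ¬ (P × Q) → Th (¬' (φ ∧' ψ))
          false ¬p×q with em {P}
          ... | yes p = Th-map (λ ¬ψ → ⇒I (⇒E (weaken-∷ ¬ψ) (∧E₂ (hyp (here refl))))) (ψ⁻ (λ q → ¬p×q (p , q)))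
          ... | no ¬p = Th-map (λ ¬φ → ⇒I (⇒E (weaken-∷ ¬φ) (∧E₁ (hyp (here refl))))) (φ⁻ ¬p)

      decided-∨ : Decided P φ → Decided Q ψ → Decided (P ⊎ Q) (φ ∨' ψ)
      decided-∨ (φ⁺ , φ⁻) (ψ⁺ , ψ⁻) = Sum.[ Th-map ∨I₁ ∘ φ⁺ , Th-map ∨I₂ ∘ ψ⁺ ] , false
        where
          refute : {χ : Formula Γ} {H : List (Formula Γ)} → H ⊢[ Γ ] ¬' χ → (χ ∷ (φ ∨' ψ) ∷ H) ⊢[ Γ ] ⊥'
          refute ¬χ = ⇒E (weaken-∷ (weaken-∷ ¬χ)) (hyp (here refl))
          false : ¬ (P ⊎ Q) → Th (¬' (φ ∨' ψ))
          false ¬p⊎q = Th-map₂ (λ ¬φ ¬ψ → ⇒I (∨E (hyp (here refl)) (refute ¬φ) (refute ¬ψ)))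
                               (φ⁻ (¬p⊎q ∘ inj₁)) (ψ⁻ (¬p⊎q ∘ inj₂))

    decided-atom : (ρ : Assignment Model Δ) (p : Pred ss) (us : Terms Δ ss) → symbols (atom p us) ⊆ signature →
                   Decided (Sat Model ρ (atom p us)) (subF ⟦ ρ ⟧ (atom p us))
    decided-atom ρ p us ⊆sig = atom-cong p ≈us , false
      where
        ≈us : termsOf (evalTs Model ρ us) ≈ subTs ⟦ ρ ⟧ us
        ≈us = evalTs-≈ ρ us (⊆sig ∘ there)
        false : ¬ Sat Model ρ (atom p us) → Th (¬' (atom p (subTs ⟦ ρ ⟧ us)))
        false ¬sat with Th-decides (atom∈atoms p (⊆sig (here refl)) (proj₂ (termsOf-enumerated (evalTs Model ρ us))))
        ... | inj₁ sat = contradiction sat ¬sat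
        ... | inj₂ ¬th = ¬atom-cong p ≈us ¬th

    decided-≐ : (ρ : Assignment Model Δ) (a b : Term Δ s) → symbols (a ≐ b) ⊆ signature →
                Decided (Sat Model ρ (a ≐ b)) (subF ⟦ ρ ⟧ (a ≐ b))
    decided-≐ {s = s} ρ a b ⊆sig = true , false
      where
        x y : Carrier s
        x = evalT Model ρ a
        y = evalT Model ρ b
        x~a : proj₁ x ~ subT ⟦ ρ ⟧ a
        x~a = evalT-~ ρ a (⊆-++⁻ˡ ⊆sig)
        y~b : proj₁ y ~ subT ⟦ ρ ⟧ b
        y~b = evalT-~ ρ b (⊆-++⁻ʳ (symbolsT a) ⊆sig)
        true : x ≡ y → subT ⟦ ρ ⟧ a ~ subT ⟦ ρ ⟧ b
        true x≡y = ~-trans (~-sym x~a) (subst (_~ _) (cong proj₁ (sym x≡y)) y~b)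
        false : x ≢ y → Th (¬' (subT ⟦ ρ ⟧ a ≐ subT ⟦ ρ ⟧ b))
        false x≢y with Carrier-enumerated x | Carrier-enumerated y
        ... | d , x∈ | e , y∈
          with Th-decides (≐∈atoms (d ⊔ e) (level-mono (≤⇒≤′ (m≤m⊔n d e)) x∈) (level-mono (≤⇒≤′ (m≤n⊔m d e)) y∈))
        ... | inj₁ x~y = contradiction (Carrier-≡ (trans (sym (proj₂ x)) (trans (rep-cong x~y) (proj₂ y)))) x≢y
        ... | inj₂ x≁y = ¬≐-cong x~a y~b x≁y

    decided-qf : (ρ : Assignment Model Δ) {φ : Formula Δ} → QuantifierFree φ → symbols φ ⊆ signature →
                 Decided (Sat Model ρ φ) (subF ⟦ ρ ⟧ φ)
    decided-qf ρ (atom p us) ⊆sig = decided-atom ρ p us ⊆sig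
    decided-qf ρ (eq a b) ⊆sig = decided-≐ ρ a b ⊆sig
    decided-qf ρ bot _ = (λ ()) , (λ _ → zero , ⇒I (hyp (here refl)))
    decided-qf ρ {φ ⇒ ψ} (imp q r) ⊆sig =
      decided-⇒ (decided-qf ρ q (⊆-++⁻ˡ ⊆sig)) (decided-qf ρ r (⊆-++⁻ʳ (symbols φ) ⊆sig))
    decided-qf ρ {φ ∧' ψ} (and q r) ⊆sig =
      decided-∧ (decided-qf ρ q (⊆-++⁻ˡ ⊆sig)) (decided-qf ρ r (⊆-++⁻ʳ (symbols φ) ⊆sig))
    decided-qf ρ {φ ∨' ψ} (or q r) ⊆sig =
      decided-∨ (decided-qf ρ q (⊆-++⁻ˡ ⊆sig)) (decided-qf ρ r (⊆-++⁻ʳ (symbols φ) ⊆sig))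

    subF-⟦∷⟧ : (ρ : Assignment Model Δ) (x : Carrier s) (φ : Formula (s ∷ Δ)) →
               subF (liftS ⟦ ρ ⟧) φ [ proj₁ x ] ≡ subF ⟦ x ∷ ρ ⟧ φ
    subF-⟦∷⟧ ρ x φ =
      trans (subF-liftS-[] ⟦ ρ ⟧ (proj₁ x) φ) (subF-cong (λ { (here refl) → refl ; (there v) → refl }) φ)

    truth-∃ : (ρ : Assignment Model Δ) {φ : Formula Δ} → Existential φ → symbols φ ⊆ signature →
              Sat Model ρ φ → Th (subF ⟦ ρ ⟧ φ)
    truth-∃ ρ (qf q) ⊆sig = proj₁ (decided-qf ρ q ⊆sig)
    truth-∃ ρ {∃' s φ} (∃' e) ⊆sig (x , sat) =
      Th-map (∃I (proj₁ x)) (subst Th (sym (subF-⟦∷⟧ ρ x φ)) (truth-∃ (x ∷ ρ) e ⊆sig sat))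

    truth-∀ : (ρ : Assignment Model Δ) {φ : Formula Δ} → Universal φ → symbols φ ⊆ signature →
              Th (subF ⟦ ρ ⟧ φ) → Sat Model ρ φ
    truth-∀ ρ {φ} (qf q) ⊆sig th with em {Sat Model ρ φ}
    ... | yes sat = sat
    ... | no ¬sat = ⊥-elim (Th-excluded th (proj₂ (decided-qf ρ q ⊆sig) ¬sat))
    truth-∀ ρ {φ ∧' ψ} (u ∧' v) ⊆sig th =
      truth-∀ ρ u (⊆-++⁻ˡ ⊆sig) (Th-map ∧E₁ th) , truth-∀ ρ v (⊆-++⁻ʳ (symbols φ) ⊆sig) (Th-map ∧E₂ th)
    truth-∀ ρ {∀' s φ} (∀' u) ⊆sig th x =
      truth-∀ (x ∷ ρ) u ⊆sig (subst Th (subF-⟦∷⟧ ρ x φ) (Th-map (λ ∀φ → ∀E ∀φ (proj₁ x)) th))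
    truth-∀ ρ (¬∃ e) ⊆sig th sat = Th-excluded (truth-∃ ρ e (⊆-++⁻ˡ ⊆sig) sat) th

    ρ₀ : Assignment Model Γ
    ρ₀ = All.tabulate (canon ∘ var)

    Th-⟦ρ₀⟧ : {φ : Formula Γ} → Th φ → Th (subF ⟦ ρ₀ ⟧ φ)
    Th-⟦ρ₀⟧ {φ} = Th-~ˢ φ var~rep ∘ subst Th (sym (subF-var φ))
      where
        var~rep : {s : Sort} (v : s ∈ Γ) → var v ~ ⟦ ρ₀ ⟧ v
        var~rep v = subst (var v ~_) (cong proj₁ (sym (lookup-tabulate (canon ∘ var) v)))
                          (~-sym (rep-~ (Enumerated⇒Witnessed (var-enumerated v))))

    Model-satisfies : All Universal H0 → All (Sat Model ρ₀) H0
    Model-satisfies universal = All.tabulate λ φ∈ →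
      truth-∀ ρ₀ (All.lookup universal φ∈) (λ x∈ → ∈-concat⁺′ x∈ (∈-map⁺ symbols φ∈))
              (Th-⟦ρ₀⟧ (zero , hyp φ∈))

  -- A variable of every sort keeps the carriers of the term model nonempty.
  refute : {Γ : Ctx} → (∀ s → s ∈ Γ) → {Hs : List (Formula Γ)} → All Universal Hs →
           ((M : Structure) (ρ : Assignment M Γ) → All (Sat M ρ) Hs → ⊥) → Hs ⊢[ Γ ] ⊥'
  refute {Γ} inh {Hs} universal unsatisfiable with em {Hs ⊢[ Γ ] ⊥'}
  ... | yes Hs⊢⊥ = Hs⊢⊥
  ... | no Hs⊬⊥ = ⊥-elim (unsatisfiable Model ρ₀ (Model-satisfies universal))
    where open TermModel Γ inh Hs Hs⊬⊥

  refute-∃ : {Γ : Ctx} → (∀ s → s ∈ Γ) → (ys : Ctx) {χ : Formula (ys ++ Γ)} {Hs : List (Formula Γ)} →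
             QuantifierFree χ → All Universal Hs →
             ((M : Structure) (ρ : Assignment M Γ) → Sat M ρ (∃* ys χ) → All (Sat M ρ) Hs → ⊥) →
             (∃* ys χ ∷ Hs) ⊢[ Γ ] ⊥'
  refute-∃ {Γ} inh ys {χ} {Hs} qf-χ universal unsatisfiable =
    ∃*-elim ys (hyp (here refl))
      (weaken (⊆.∷⁺ʳ χ (⊆.map⁺ _ there)) (refute (∈-++⁺ʳ ys ∘ inh) universal′ unsatisfiable′))
    where
      universal′ : All Universal (χ ∷ map (renF (∈-++⁺ʳ ys)) Hs)
      universal′ = qf qf-χ ∷ map⁺ (All.map (Universal-renF _) universal)
      unsatisfiable′ : (M : Structure) (ρ′ : Assignment M (ys ++ Γ)) →
                       All (Sat M ρ′) (χ ∷ map (renF (∈-++⁺ʳ ys)) Hs) → ⊥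
      unsatisfiable′ M ρ′ =
        subst (λ ρ′ → All (Sat M ρ′) _ → ⊥) (++⁺-++⁻ ys ρ′) (split (++⁻ˡ ys ρ′) (++⁻ʳ ys ρ′))
        where
          split : (as : All (Structure.Carrier M) ys) (ρ : Assignment M Γ) →
                  All (Sat M (++⁺ as ρ)) (χ ∷ map (renF (∈-++⁺ʳ ys)) Hs) → ⊥
          split as ρ (sat-χ ∷ sat-Hs) =
            unsatisfiable M ρ (from (sat-∃* M ys ρ χ) (as , sat-χ))
              (All.map (λ {φ} → to (sat-renF M {π = ∈-++⁺ʳ ys} {++⁺ as ρ} {ρ} (λ v → sym (lookup-∈-++⁺ʳ as ρ v)) φ))
                       (map⁻ sat-Hs))

module ClauseSetCycles (L : Language) (em : ExcludedMiddle 0ℓ) where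
  open FOL L
  open Substitution L
  open Semantics L
  open Derivations L
  open Fragments L
  open PrenexClauseSets L
  open Completeness L em

  x₀ : Term (nat ∷ Γ) nat
  x₀ = var (here refl)

  induction : {ψ : Formula (nat ∷ [])} (κ : Ren [] Γ) {Hs : List (Formula Γ)} → renF κ (IndAx [] ψ) ∈ Hs →
              Hs ⊢[ Γ ] ψ ⟨ zeroT ⟩ → (ψ ⟨ x₀ ⟩ ∷ map wk Hs) ⊢[ nat ∷ Γ ] ψ ⟨ succT x₀ ⟩ →
              (u : Term Γ nat) → Hs ⊢[ Γ ] ψ ⟨ u ⟩
  induction {Γ} {ψ} κ {Hs} ax base step u =
    subst (Hs ⊢[ Γ ]_) at-u (∀E (⇒E (⇒E (hyp ax) (subst (Hs ⊢[ Γ ]_) (sym at-0) base)) (∀I (⇒I step′))) u)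
    where
      at-0 : renF κ (at0 ψ) ≡ ψ ⟨ zeroT ⟩
      at-0 = trans (renF-subF κ (σ₀ zeroT) ψ) (subF-only _ ψ)
      at-x₀ : renF (liftR κ) ψ ≡ ψ ⟨ x₀ ⟩
      at-x₀ = trans (renF≡subF (liftR κ) ψ) (subF-only _ ψ)
      at-succ : renF (liftR κ) (atSucc ψ) ≡ ψ ⟨ succT x₀ ⟩
      at-succ = trans (renF-subF (liftR κ) σsucc ψ) (subF-only _ ψ)
      at-u : renF (liftR κ) ψ [ u ] ≡ ψ ⟨ u ⟩
      at-u = trans (subF-renF (σ₀ u) (liftR κ) ψ) (subF-only _ ψ)
      step′ : (renF (liftR κ) ψ ∷ map wk Hs) ⊢[ nat ∷ Γ ] renF (liftR κ) (atSucc ψ)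
      step′ = subst₂ (λ φ χ → (φ ∷ map wk Hs) ⊢[ nat ∷ Γ ] χ) (sym at-x₀) (sym at-succ) step

  module _ (S : ClauseSet (nat ∷ [])) where

    Sᶠ : Formula (nat ∷ [])
    Sᶠ = clauseSetF S

    ys : Ctx
    ys = clauseSetVars S

    ψ : Formula (nat ∷ [])
    ψ = clauseSetNegation S

    QuantifierFree-¬matrix : QuantifierFree (¬' (clauseSetMatrix S))
    QuantifierFree-¬matrix = imp (QuantifierFree-clauseSetMatrix S) bot

    ψ⇔¬S : (M : Structure) (ρ : Assignment M Γ) (u : Term Γ nat) → Sat M ρ (ψ ⟨ u ⟩) ⇔ (¬ Sat M ρ (Sᶠ ⟨ u ⟩))
    ψ⇔¬S M ρ u =
      ⇔-trans (sat-⟨⟩ M ρ u ψ) (⇔-trans (sat-clauseSetNegation M em S _) (¬-cong-⇔ (⇔-sym (sat-⟨⟩ M ρ u Sᶠ))))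

    module _ {Γ : Ctx} (inh : ∀ s → s ∈ Γ) where

      refute-ψ : (u : Term Γ nat) {Hs : List (Formula Γ)} → All Universal Hs →
                 ((M : Structure) (ρ : Assignment M Γ) → Sat M ρ (ψ ⟨ u ⟩) → All (Sat M ρ) Hs → ⊥) →
                 (ψ ⟨ u ⟩ ∷ Hs) ⊢[ Γ ] ⊥'
      refute-ψ u {Hs} universal unsatisfiable =
        subst (λ φ → (φ ∷ Hs) ⊢[ Γ ] ⊥') (sym prenex)
          (refute-∃ inh ys (QuantifierFree-subF _ QuantifierFree-¬matrix) universal
             (λ M ρ → unsatisfiable M ρ ∘ subst (Sat M ρ) (sym prenex)))
        where
          prenex : ψ ⟨ u ⟩ ≡ ∃* ys (subF (liftS* ys (only u)) (¬' (clauseSetMatrix S)))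
          prenex = subF-∃* ys (only u) (¬' (clauseSetMatrix S))

      Universal-¬ψ : (u : Term Γ nat) → Universal (¬' (ψ ⟨ u ⟩))
      Universal-¬ψ u = ¬∃ (Existential-subF _ (Existential-∃* ys (qf QuantifierFree-¬matrix)))

      ψ-refutes-S : (u : Term Γ nat) → (ψ ⟨ u ⟩ ∷ Sᶠ ⟨ u ⟩ ∷ []) ⊢[ Γ ] ⊥'
      ψ-refutes-S u = refute-ψ u (Universal-subF _ (Universal-clauseSetF S) ∷ []) λ { M ρ ψu (Su ∷ []) →
        to (ψ⇔¬S M ρ u) ψu Su }

    module _ (cycle : IsClauseSetCycle S) where
      open IsClauseSetCycle cycle

      S-fails-at-zero : (M : Structure) (ρ : Assignment M Γ) → ¬ Sat M ρ (Sᶠ ⟨ zeroT ⟩)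
      S-fails-at-zero M ρ =
        base M [] ∘ from (sat-subF M {σ = σ₀ zeroT} (λ { (here refl) → refl ; (there ()) }) Sᶠ)
        ∘ to (sat-⟨⟩ M ρ zeroT Sᶠ)

      S-descends : (M : Structure) (ρ : Assignment M Γ) (u : Term Γ nat) →
                   Sat M ρ (Sᶠ ⟨ succT u ⟩) → Sat M ρ (Sᶠ ⟨ u ⟩)
      S-descends M ρ u =
        from (sat-⟨⟩ M ρ u Sᶠ) ∘ step M (evalT M ρ u ∷ [])
        ∘ from (sat-subF M {σ = σsucc} (λ { (here refl) → refl ; (there ()) }) Sᶠ) ∘ to (sat-⟨⟩ M ρ (succT u) Sᶠ)

      module _ {Γ : Ctx} (inh : ∀ s → s ∈ Γ) where

        ψ-zero : [] ⊢[ Γ ] ψ ⟨ zeroT ⟩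
        ψ-zero = raa (refute inh (Universal-¬ψ inh zeroT ∷ []) λ { M ρ (¬ψ ∷ []) →
          ¬ψ (from (ψ⇔¬S M ρ zeroT) (S-fails-at-zero M ρ)) })

        ψ-succ : (u : Term Γ nat) → (ψ ⟨ u ⟩ ∷ []) ⊢[ Γ ] ψ ⟨ succT u ⟩
        ψ-succ u = raa (weaken swap (refute-ψ inh u (Universal-¬ψ inh (succT u) ∷ []) λ { M ρ ψu (¬ψsu ∷ []) →
          ¬ψsu (from (ψ⇔¬S M ρ (succT u)) (to (ψ⇔¬S M ρ u) ψu ∘ S-descends M ρ u)) }))
          where
            swap : {φ χ : Formula Γ} → (φ ∷ χ ∷ []) ⊆ (χ ∷ φ ∷ [])
            swap (here refl) = there (here refl)
            swap (there (here refl)) = here refl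

      ¬S-derivable : {Γ : Ctx} → (∀ s → s ∈ Γ) →
                     map (wkClosed Γ) (IndAx [] ψ ∷ []) ⊢[ Γ ] wkClosed Γ (∀ᶜ (nat ∷ []) (¬' Sᶠ))
      ¬S-derivable {Γ} inh = ∀I (subst (map (wk {s = nat}) axioms ⊢[ nat ∷ Γ ]_) (sym (at-x₀ _)) (⇒I refutation))
        where
          inh′ : ∀ s → s ∈ nat ∷ Γ
          inh′ = there ∘ inh
          at-x₀ : (κ : Ren [] Γ) → renF (liftR κ) (¬' Sᶠ) ≡ ¬' (Sᶠ ⟨ x₀ ⟩)
          at-x₀ κ = trans (renF≡subF (liftR κ) (¬' Sᶠ)) (subF-only _ (¬' Sᶠ))
          axioms : List (Formula Γ)
          axioms = map (wkClosed Γ) (IndAx [] ψ ∷ [])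
          hyps : List (Formula (nat ∷ Γ))
          hyps = Sᶠ ⟨ x₀ ⟩ ∷ map (wk {s = nat}) axioms
          ψ-x₀ : hyps ⊢[ nat ∷ Γ ] ψ ⟨ x₀ ⟩
          ψ-x₀ = induction _ (there (here (sym (renF-renF there _ (IndAx [] ψ)))))
                   (weaken (λ ()) (ψ-zero inh′)) (weaken (⊆.∷⁺ʳ _ λ ()) (ψ-succ (there ∘ inh′) x₀)) x₀
          refutation : hyps ⊢[ nat ∷ Γ ] ⊥'
          refutation = cut ψ-x₀ (weaken (⊆.∷⁺ʳ _ (⊆.∷⁺ʳ _ λ ())) (ψ-refutes-S inh′ x₀))

proposition2p8 : (L : Language) → ExcludedMiddle 0ℓ →
    let open FOL L in
      (S : ClauseSet (nat ∷ [])) → IsClauseSetCycle S →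
      I∃₁ ⊢ ∀ᶜ (nat ∷ []) (¬' (clauseSetF S))
proposition2p8 L em S cycle =
  IndAx [] (ψ S) ∷ [] ,
  ind [] (ys S) (¬' (clauseSetMatrix S)) (QuantifierFree-¬matrix S) ∷ [] ,
  allFin numSorts ,
  ¬S-derivable S cycle ∈-allFin
  where
    open FOL L
    open PrenexClauseSets L
    open ClauseSetCycles L em
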